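{- Let $\alpha\in\{0,1,2\}^*$ and let $c_\infty[\alpha]$ be the CQCA limit configuration on input $\alpha$. Let $e\in\mathbb{Z}^2$ be an anchor cell, i.e. a position such that both cells $e+(0,1)$ and $e+(-1,0)$ are defined in $c_\infty[\alpha]$, and let $s\in\{0,1\}$ be the sum bit of the cell at $e+(-1,0)$. Then $s$ is the parity of the number $m$ given in base $3'$ by the defined cells of the column starting at $e+(0,1)$ and going north: $m$ is even iff $s=0$ and odd iff $s=1$.
   Context: Base $3'$ words are words over $\{0,\bar0,1,\bar1\}$; the symbol-wise map $0\mapsto0,\ \bar0\mapsto1,\ 1\mapsto1,\ \bar1\mapsto2$ turns such a word $q$ into a ternary word, and $[q]_{3'}$ is its base 3 value. The encoding $\langle\alpha\rangle_{3'}$ of a ternary word $\alpha$ (indexed from the right) replaces each $0$ by $0$, each $2$ by $\bar1$, and each $1$ by $1$ if the nearest symbol to its right (towards the least significant end) that is different from $1$ exists and is a $2$, and by $\bar0$ otherwise. The CQCA. State space $S=\{0,1,\bot\}^2\setminus\{(\bot,0),(\bot,1)\}$; a state $(s,k)$ has sum bit $s$ and carry bit $k$. A state is undefined if $(\bot,\bot)$, half-defined if $(s,\bot)$ with $s\in\{0,1\}$, defined if $(s,k)$ with $s,k\in\{0,1\}$. Defined states $(0,0),(0,1),(1,0),(1,1)$ correspond to base $3'$ symbols $0,\bar0,1,\bar1$. A configuration is a map $c:\mathbb{Z}^2\to S$. Let $E=(1,0)$, $W=(-1,0)$, $N=(0,1)$. One step $F(c)$: first apply the non-local rule at every position to $c$,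 obtaining $c'$, then the local rule at every position to $c'$. Non-local rule at $p$: (i) if $c(p+W)=(1,\bot)$, $c(p)=(s,\bot)$ with $s\in\{0,\bot\}$, and for all $i\ge1$, $c(p+iE)=(s'',\bot)$ with $s''\in\{0,\bot\}$, then $c'(p)=(0,1)$; (ii) else if $c(p+W)=(0,\bot)$, $c(p)=(0,\bot)$ and there is $i\ge1$ with $c(p+iW)=(1,\bot)$, then $c'(p)=(0,0)$; (iii) otherwise $c'(p)=c(p)$. Local rule at $p$: (i) if $c'(p)=(s,\bot)$ is half-defined and $c'(p+E)=(s',k')$ is defined, then $F(c)(p)=(s,k)$ with $k=1$ iff $s+s'+k'\ge2$; (ii) if $c'(p)=(\bot,\bot)$, $c'(p+N)=(s,\bot)$ is half-defined and $c'(p+N+E)=(s',k')$ is defined, then $F(c)(p)=((s+s'+k')\bmod2,\bot)$; (iii) otherwise $F(c)(p)=c'(p)$. Initial configuration $c_0[\alpha]$: with $\alpha'=\langle\alpha\rangle_{3'}$, $c_0[\alpha](0,i)$ is the defined state corresponding to $\alpha'_{i-1}$ for $1\le i\le|\alpha|$, $c_0[\alpha](x,|\alpha|)=(0,\bot)$ for all $x<0$, and $(\bot,\bot)$ elsewhere. Every cell changes state finitely often, and $c_\infty[\alpha]=\lim_{i\to\infty}F^i(c_0[\alpha])$ (pointwise). Reading columns: a contiguous vertical segment of defined cells gives the base $3'$ word obtained by concatenating the symbols of its cells, the southmost cell giving the least significant symbol. -}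

module Defs where

open import Data.Bool using (Bool; true; false)
open import Data.Nat using (ℕ; zero; suc; _+_; _*_; _≤_; _<_; _≤ᵇ_; _%_; _≡ᵇ_)
import Data.Nat as ℕ
open import Data.Integer using (ℤ; +_; -[1+_]) renaming (_+_ to _+ℤ_; _-_ to _-ℤ_)
open import Data.Fin using (Fin; zero; suc)
open import Data.List using (List; []; _∷_; length)
open import Data.Maybe using (Maybe; just; nothing)
open import Data.Product using (_×_; _,_; Σ; ∃)
open import Data.Sum using (_⊎_)
open import Relation.Nullary using (¬_; does)
open import Relation.Binary.PropositionalEquality using (_≡_)

bitℕ : Bool → ℕ
bitℕ false = 0
bitℕ true  = 1

-- S = {0,1,⊥}² ∖ {(⊥,0),(⊥,1)}
data State : Set where
  undef : State                 -- (⊥,⊥)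
  half  : Bool → State          -- (s,⊥), s ∈ {0,1}
  def   : Bool → Bool → State   -- (s,k), s,k ∈ {0,1}

data IsDefined : State → Set where
  isDef : ∀ s k → IsDefined (def s k)

data Sym3' : Set where
  s0 s0̄ s1 s1̄ : Sym3'

symState : Sym3' → State
symState s0  = def false false
symState s0̄  = def false true
symState s1  = def true  false
symState s1̄  = def true  true

symDigit : Sym3' → ℕ
symDigit s0  = 0
symDigit s0̄  = 1
symDigit s1  = 1
symDigit s1̄  = 2

-- Convention: words are lists with the LEAST significant symbol first
-- (list position i holds the symbol of index i, words being indexed from
-- the right).

val3' : List Sym3' → ℕ
val3' []       = 0
val3' (x ∷ xs) = symDigit x + 3 * val3' xs

-- ⟨α⟩_{3'} : encoding of a ternary word (least significant digit first).
-- The flag records whether the nearest symbol to the right (= earlier in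
-- the list) different from 1 exists and is a 2.
encode3'-aux : Bool → List (Fin 3) → List Sym3'
encode3'-aux f []                    = []
encode3'-aux f (zero ∷ xs)           = s0 ∷ encode3'-aux false xs
encode3'-aux f (suc (suc zero) ∷ xs) = s1̄ ∷ encode3'-aux true xs
encode3'-aux true  (suc zero ∷ xs)   = s1 ∷ encode3'-aux true xs
encode3'-aux false (suc zero ∷ xs)   = s0̄ ∷ encode3'-aux false xs

encode3' : List (Fin 3) → List Sym3'
encode3' = encode3'-aux false

Pos : Set
Pos = ℤ × ℤ

Config : Set
Config = Pos → State

_⊕_ : Pos → Pos → Pos
(a , b) ⊕ (c , d) = (a +ℤ c , b +ℤ d)

E W N : Pos
E = (+ 1 , + 0)
W = (-[1+ 0 ] , + 0)
N = (+ 0 , + 1)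

_+iE_ : Pos → ℕ → Pos
(x , y) +iE i = (x +ℤ + i , y)

_+iW_ : Pos → ℕ → Pos
(x , y) +iW i = (x -ℤ + i , y)

ZeroOrUndef : State → Set
ZeroOrUndef st = (st ≡ half false) ⊎ (st ≡ undef)

NLcond1 : Config → Pos → Set
NLcond1 c p = (c (p ⊕ W) ≡ half true) × ZeroOrUndef (c p)
            × (∀ i → 1 ≤ i → ZeroOrUndef (c (p +iE i)))

NLcond2 : Config → Pos → Set
NLcond2 c p = (c (p ⊕ W) ≡ half false) × (c p ≡ half false)
            × ∃ (λ i → 1 ≤ i × c (p +iW i) ≡ half true)

NonLocal : Config → Config → Set
NonLocal c c' = ∀ p →
    (NLcond1 c p → c' p ≡ def false true)
  × (¬ NLcond1 c p → NLcond2 c p → c' p ≡ def false false)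
  × (¬ NLcond1 c p → ¬ NLcond2 c p → c' p ≡ c p)

sum3 : Bool → Bool → Bool → ℕ
sum3 a b d = bitℕ a + bitℕ b + bitℕ d

localCell : State → State → State → State → State
localCell (half s) (def s' k') _ _ = def s (2 ≤ᵇ sum3 s s' k')
localCell undef _ (half s) (def s' k') = half ((sum3 s s' k' % 2) ≡ᵇ 1)
localCell x _ _ _ = x

localRule : Config → Config
localRule c p = localCell (c p) (c (p ⊕ E)) (c (p ⊕ N)) (c ((p ⊕ N) ⊕ E))

Step : Config → Config → Set
Step c d = Σ Config (λ c' → NonLocal c c' × (∀ p → d p ≡ localRule c' p))

nth : {A : Set} → List A → ℕ → Maybe A
nth []       _       = nothing
nth (x ∷ xs) zero    = just x
nth (x ∷ xs) (suc n) = nth xs n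

initCol : List Sym3' → ℕ → State
initCol α' j with nth α' j
... | just a  = symState a
... | nothing = undef

c₀ : List (Fin 3) → Config
c₀ α (+ zero , + suc j) = initCol (encode3' α) j
c₀ α (+ zero , _)       = undef
c₀ α (-[1+ _ ] , + n) with does (n ℕ.≟ length α)
... | true  = half false
... | false = undef
c₀ α (-[1+ _ ] , -[1+ _ ]) = undef
c₀ α (+ suc _ , _)         = undef

IsOrbit : List (Fin 3) → (ℕ → Config) → Set
IsOrbit α cs = (∀ p → cs 0 p ≡ c₀ α p) × (∀ n → Step (cs n) (cs (suc n)))

IsPointwiseLimit : (ℕ → Config) → Config → Set
IsPointwiseLimit cs cinf = ∀ p → ∃ (λ M → ∀ n → M ≤ n → cs n p ≡ cinf p)

{-# OPTIONS --safe #-}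
module Submission where

-- Every configuration of the orbit satisfies an invariant [Inv] whose main clause,
-- [sum-justified], says that the sum bit of each cell is an input digit (column 0),
-- a 0 of the initial top row, or the xor of the sum bit north of it with both bits
-- of the defined cell north-east of it, i.e. the value local rule (ii) put there.
-- The other clauses describe the possible shapes of rows; they make the invariant
-- inductive under the non-local rule, which only writes (0,1) or (0,0) right after
-- a (1,⊥) or (0,⊥), and under the local rule. Since [sum-justified] mentions only
-- finitely many cells around a position, it passes to the pointwise limit. There
-- the cell e + W lies south-west of the column of digits, and unfolding
-- [sum-justified] up the column, whose top digit has a 0 of the top row to its
-- west, expresses its sum bit as the xor of the bits of all digits. As
-- 3 is odd and a base 3' digit with bits (u,v) has value ≡ u + v (mod 2), this is
-- the parity of m.

open import Defs
open import Data.Bool using (Bool; true; false; _xor_; T)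
open import Data.Bool.Properties using () renaming (_≟_ to _≟ᵇ_)
open import Data.Empty using (⊥; ⊥-elim)
open import Data.Fin using (Fin; toℕ) renaming (zero to fzero; suc to fsuc)
open import Data.Integer as ℤ using (ℤ; +_; -[1+_]; 1ℤ; +<+; _<_)
import Data.Integer.Properties as ℤP
open import Data.List using (List; []; _∷_; length; lookup)
open import Data.Maybe using (Maybe; just; nothing)
open import Data.Nat as ℕ using (ℕ; zero; suc; s≤s; z≤n; _%_; parity)
import Data.Nat.Properties as ℕP
open import Data.Nat.DivMod using ([m+n]%n≡m%n)
open import Data.Parity.Base as ℙ using (Parity; 0ℙ; 1ℙ)
import Data.Parity.Properties as ℙP
open import Data.Product using (_×_; _,_; Σ; proj₁; proj₂)
open import Data.Sum using (_⊎_; inj₁; inj₂)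
open import Function using (_∘_; case_of_)
open import Relation.Binary using (tri<; tri≈; tri>)
open import Relation.Binary.PropositionalEquality
open import Relation.Nullary using (¬_; Dec; yes; no)
open import Relation.Nullary.Decidable using (decidable-stable; ¬¬-excluded-middle; _×-dec_; _⊎-dec_)

-- Geometry of the grid

x y : Pos → ℤ
x = proj₁
y = proj₂

east west north : Pos → Pos
east  p = (ℤ.suc (x p) , y p)
west  p = (ℤ.pred (x p) , y p)
north p = (x p , ℤ.suc (y p))

east-west : ∀ p → east (west p) ≡ p
east-west p = cong (_, y p) (ℤP.suc-pred (x p))

west-east : ∀ p → west (east p) ≡ p
west-east p = cong (_, y p) (ℤP.pred-suc (x p))

⊕E≡east : ∀ p → p ⊕ E ≡ east p
⊕E≡east p = cong₂ _,_ (ℤP.+-comm (x p) 1ℤ) (ℤP.+-identityʳ (y p))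

⊕W≡west : ∀ p → p ⊕ W ≡ west p
⊕W≡west p = cong₂ _,_ (ℤP.+-comm (x p) ℤ.-1ℤ) (ℤP.+-identityʳ (y p))

⊕N≡north : ∀ p → p ⊕ N ≡ north p
⊕N≡north p = cong₂ _,_ (ℤP.+-identityʳ (x p)) (ℤP.+-comm (y p) 1ℤ)

⊕N⊕E≡east-north : ∀ p → (p ⊕ N) ⊕ E ≡ east (north p)
⊕N⊕E≡east-north p = trans (cong (_⊕ E) (⊕N≡north p)) (⊕E≡east (north p))

east^ west^ north^ : ℕ → Pos → Pos
east^ zero p = p
east^ (suc i) p = east (east^ i p)
west^ zero p = p
west^ (suc i) p = west (west^ i p)
north^ zero p = p
north^ (suc i) p = north (north^ i p)

+-sucʳ : ∀ a i → a ℤ.+ + suc i ≡ ℤ.suc (a ℤ.+ + i)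
+-sucʳ a i = begin
  a ℤ.+ (1ℤ ℤ.+ + i)  ≡⟨ ℤP.+-assoc a 1ℤ (+ i) ⟨
  (a ℤ.+ 1ℤ) ℤ.+ + i  ≡⟨ cong (ℤ._+ + i) (ℤP.+-comm a 1ℤ) ⟩
  (1ℤ ℤ.+ a) ℤ.+ + i  ≡⟨ ℤP.+-assoc 1ℤ a (+ i) ⟩
  ℤ.suc (a ℤ.+ + i)   ∎
  where open ≡-Reasoning

+iE≡east^ : ∀ p i → p +iE i ≡ east^ i p
+iE≡east^ p zero = cong (_, y p) (ℤP.+-identityʳ (x p))
+iE≡east^ p (suc i) = trans (cong (_, y p) (+-sucʳ (x p) i)) (cong east (+iE≡east^ p i))

+iW≡west^ : ∀ p i → p +iW i ≡ west^ i p
+iW≡west^ p zero = cong (_, y p) (ℤP.+-identityʳ (x p))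
+iW≡west^ p (suc i) = trans (cong (_, y p) (ℤP.minus-suc (x p) i)) (cong west (+iW≡west^ p i))

⊕column≡north^ : ∀ p i → p ⊕ (+ 0 , + i) ≡ north^ i p
⊕column≡north^ p zero = cong₂ _,_ (ℤP.+-identityʳ (x p)) (ℤP.+-identityʳ (y p))
⊕column≡north^ p (suc i) =
  trans (cong₂ _,_ refl (+-sucʳ (y p) i)) (cong north (⊕column≡north^ p i))

east^-east : ∀ i p → east^ i (east p) ≡ east (east^ i p)
east^-east zero p = refl
east^-east (suc i) p = cong east (east^-east i p)

west^-east : ∀ k p → west^ (suc k) (east p) ≡ west^ k p
west^-east zero p = west-east p
west^-east (suc k) p = cong west (west^-east k p)

west^-east^-≤ : ∀ k i p → k ℕ.≤ i → west^ k (east^ i p) ≡ east^ (i ℕ.∸ k) p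
west^-east^-≤ zero i p _ = refl
west^-east^-≤ (suc k) (suc i) p (s≤s k≤i) = trans (west^-east k (east^ i p)) (west^-east^-≤ k i p k≤i)

west^-east^-≥ : ∀ k i p → i ℕ.≤ k → west^ k (east^ i p) ≡ west^ (k ℕ.∸ i) p
west^-east^-≥ k zero p _ = refl
west^-east^-≥ (suc k) (suc i) p (s≤s i≤k) = trans (west^-east k (east^ i p)) (west^-east^-≥ k i p i≤k)

north-east^ : ∀ i p → north (east^ i p) ≡ east^ i (north p)
north-east^ zero p = refl
north-east^ (suc i) p = cong east (north-east^ i p)

north^-north : ∀ i p → north^ i (north p) ≡ north (north^ i p)
north^-north zero p = refl
north^-north (suc i) p = cong north (north^-north i p)

y-east^ : ∀ i p → y (east^ i p) ≡ y p
y-east^ zero p = refl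
y-east^ (suc i) p = y-east^ i p

y-west^ : ∀ i p → y (west^ i p) ≡ y p
y-west^ zero p = refl
y-west^ (suc i) p = y-west^ i p

data Negℤ : ℤ → Set where
  neg : ∀ {m} → Negℤ -[1+ m ]

data Posℤ : ℤ → Set where
  pos : ∀ {m} → Posℤ (+ suc m)

sign-trichotomy : ∀ a → Negℤ a ⊎ a ≡ + 0 ⊎ Posℤ a
sign-trichotomy (+ zero) = inj₂ (inj₁ refl)
sign-trichotomy (+ suc m) = inj₂ (inj₂ pos)
sign-trichotomy -[1+ m ] = inj₁ neg

Negℤ-suc⁻¹ : ∀ {a} → Negℤ (ℤ.suc a) → Negℤ a
Negℤ-suc⁻¹ { -[1+ suc m ]} neg = neg

suc≡0⇒Negℤ : ∀ {a} → ℤ.suc a ≡ + 0 → Negℤ a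
suc≡0⇒Negℤ { -[1+ zero ]} _ = neg

nonNeg-suc : ∀ {a} → a ≡ + 0 ⊎ Posℤ a → Posℤ (ℤ.suc a)
nonNeg-suc (inj₁ refl) = pos
nonNeg-suc (inj₂ pos) = pos

Posℤ-pred : ∀ {a} → Posℤ a → ℤ.pred a ≡ + 0 ⊎ Posℤ (ℤ.pred a)
Posℤ-pred {+ suc zero} pos = inj₁ refl
Posℤ-pred {+ suc (suc m)} pos = inj₂ pos

Negℤ⇒≢0 : ∀ {a} → Negℤ a → a ≢ + 0
Negℤ⇒≢0 neg ()

Negℤ⇒¬Posℤ : ∀ {a} → Negℤ a → ¬ Posℤ a
Negℤ⇒¬Posℤ neg ()

Posℤ-east^ : ∀ i p → x p ≡ + 0 ⊎ Posℤ (x p) → Posℤ (x (east^ (suc i) p))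
Posℤ-east^ zero p h = nonNeg-suc h
Posℤ-east^ (suc i) p h = nonNeg-suc (inj₂ (Posℤ-east^ i p h))

module Rows (top : ℤ) where

  <⇒suc<⊎suc≡ : ∀ {a} → a < top → ℤ.suc a < top ⊎ ℤ.suc a ≡ top
  <⇒suc<⊎suc≡ {a} a<top with ℤP.<-cmp (ℤ.suc a) top
  ... | tri< l _ _ = inj₁ l
  ... | tri≈ _ q _ = inj₂ q
  ... | tri> _ _ g = ⊥-elim (ℤP.<-irrefl refl (ℤP.<-≤-trans g (ℤP.i<j⇒suc[i]≤j a<top)))

  suc≡⇒< : ∀ {a} → ℤ.suc a ≡ top → a < top
  suc≡⇒< q = ℤP.suc[i]≤j⇒i<j (ℤP.≤-reflexive q)

  suc<⇒< : ∀ {a} → ℤ.suc a < top → a < top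
  suc<⇒< {a} l = ℤP.≤-<-trans (ℤP.i≤suc[i] a) l

  ≡⇒<suc : ∀ {a} → a ≡ top → top < ℤ.suc a
  ≡⇒<suc refl = ℤP.suc[i]≤j⇒i<j ℤP.≤-refl

  >⇒<suc : ∀ {a} → top < a → top < ℤ.suc a
  >⇒<suc {a} l = ℤP.<-≤-trans l (ℤP.i≤suc[i] a)

  trichotomy : ∀ a → a < top ⊎ a ≡ top ⊎ top < a
  trichotomy a with ℤP.<-cmp a top
  ... | tri< l _ _ = inj₁ l
  ... | tri≈ _ q _ = inj₂ (inj₁ q)
  ... | tri> _ _ g = inj₂ (inj₂ g)

  <⇒≢ : ∀ {a} → a < top → a ≢ top
  <⇒≢ l q = ℤP.<-irrefl q l

  ≡⇒≯ : ∀ {a} → a ≡ top → ¬ top < a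
  ≡⇒≯ q g = ℤP.<-irrefl (sym q) g

-- States and the local rule

data IsHalf : State → Set where
  isHalf : ∀ s → IsHalf (half s)

sumBit : State → Maybe Bool
sumBit undef = nothing
sumBit (half s) = just s
sumBit (def s _) = just s

def≢undef : ∀ {s k} → def s k ≢ undef
def≢undef ()

half≢undef : ∀ {s} → half s ≢ undef
half≢undef ()

def≢half : ∀ {s k t} → def s k ≢ half t
def≢half ()

¬IsDefined-undef : ¬ IsDefined undef
¬IsDefined-undef ()

¬IsDefined-half : ∀ {s} → ¬ IsDefined (half s)
¬IsDefined-half ()

¬IsHalf-undef : ¬ IsHalf undef
¬IsHalf-undef ()

IsDefined⇒≡def : ∀ {a} → IsDefined a → Σ Bool λ s → Σ Bool λ k → a ≡ def s k
IsDefined⇒≡def (isDef s k) = s , k , refl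

IsHalf⇒≡half : ∀ {a} → IsHalf a → Σ Bool λ s → a ≡ half s
IsHalf⇒≡half (isHalf s) = s , refl

¬ZeroOrUndef-one : ¬ ZeroOrUndef (half true)
¬ZeroOrUndef-one (inj₁ ())
¬ZeroOrUndef-one (inj₂ ())

¬ZeroOrUndef-def : ∀ {s k} → ¬ ZeroOrUndef (def s k)
¬ZeroOrUndef-def (inj₁ ())
¬ZeroOrUndef-def (inj₂ ())

IsDefined⇒¬ZeroOrUndef : ∀ {a} → IsDefined a → ¬ ZeroOrUndef a
IsDefined⇒¬ZeroOrUndef (isDef _ _) = ¬ZeroOrUndef-def

ZeroOrUndef-half⇒false : ∀ {s} → ZeroOrUndef (half s) → s ≡ false
ZeroOrUndef-half⇒false (inj₁ refl) = refl

_≟ₛ_ : (a b : State) → Dec (a ≡ b)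
undef ≟ₛ undef = yes refl
undef ≟ₛ half _ = no λ ()
undef ≟ₛ def _ _ = no λ ()
half _ ≟ₛ undef = no λ ()
half s ≟ₛ half t with s ≟ᵇ t
... | yes refl = yes refl
... | no s≢t = no λ { refl → s≢t refl }
half _ ≟ₛ def _ _ = no λ ()
def _ _ ≟ₛ undef = no λ ()
def _ _ ≟ₛ half _ = no λ ()
def s k ≟ₛ def t l with s ≟ᵇ t | k ≟ᵇ l
... | yes refl | yes refl = yes refl
... | no s≢t | _ = no λ { refl → s≢t refl }
... | _ | no k≢l = no λ { refl → k≢l refl }

isDefined? : ∀ a → Dec (IsDefined a)
isDefined? undef = no λ ()
isDefined? (half _) = no λ ()
isDefined? (def s k) = yes (isDef s k)

isHalf? : ∀ a → Dec (IsHalf a)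
isHalf? undef = no λ ()
isHalf? (half s) = yes (isHalf s)
isHalf? (def _ _) = no λ ()

zeroOrUndef? : ∀ a → Dec (ZeroOrUndef a)
zeroOrUndef? undef = yes (inj₂ refl)
zeroOrUndef? (half false) = yes (inj₁ refl)
zeroOrUndef? (half true) = no ¬ZeroOrUndef-one
zeroOrUndef? (def _ _) = no ¬ZeroOrUndef-def

sumBit≟ : ∀ a t → Dec (sumBit a ≡ just t)
sumBit≟ undef t = no λ ()
sumBit≟ (half s) t with s ≟ᵇ t
... | yes refl = yes refl
... | no s≢t = no λ { refl → s≢t refl }
sumBit≟ (def s _) t with s ≟ᵇ t
... | yes refl = yes refl
... | no s≢t = no λ { refl → s≢t refl }

sum3-parity : ∀ t u v → ((sum3 t u v % 2) ℕ.≡ᵇ 1) ≡ t xor (u xor v)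
sum3-parity false false false = refl
sum3-parity false false true = refl
sum3-parity false true false = refl
sum3-parity false true true = refl
sum3-parity true false false = refl
sum3-parity true false true = refl
sum3-parity true true false = refl
sum3-parity true true true = refl

localCell-undef⁻¹ : ∀ a b c d → localCell a b c d ≡ undef → a ≡ undef × ¬ (IsHalf c × IsDefined d)
localCell-undef⁻¹ undef b undef d _ = refl , λ { (() , _) }
localCell-undef⁻¹ undef b (half s) undef _ = refl , λ { (_ , ()) }
localCell-undef⁻¹ undef b (half s) (half _) _ = refl , λ { (_ , ()) }
localCell-undef⁻¹ undef b (def _ _) d _ = refl , λ { (() , _) }
localCell-undef⁻¹ (half s) undef c d ()
localCell-undef⁻¹ (half s) (half _) c d ()

localCell-half⁻¹ : ∀ a b c d {s} → localCell a b c d ≡ half s →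
  (a ≡ half s × ¬ IsDefined b) ⊎
  (a ≡ undef × Σ Bool λ t → Σ Bool λ u → Σ Bool λ v → c ≡ half t × d ≡ def u v × s ≡ t xor (u xor v))
localCell-half⁻¹ undef b (half t) (def u v) refl = inj₂ (refl , t , u , v , refl , refl , sum3-parity t u v)
localCell-half⁻¹ (half s) undef c d refl = inj₁ (refl , λ ())
localCell-half⁻¹ (half s) (half _) c d refl = inj₁ (refl , λ ())

localCell-def⁻¹ : ∀ a b c d {s k} → localCell a b c d ≡ def s k → a ≡ def s k ⊎ (a ≡ half s × IsDefined b)
localCell-def⁻¹ undef b undef d ()
localCell-def⁻¹ undef b (half t) undef ()
localCell-def⁻¹ undef b (half t) (half _) ()
localCell-def⁻¹ undef b (half t) (def u v) ()
localCell-def⁻¹ undef b (def _ _) d ()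
localCell-def⁻¹ (half s) undef c d ()
localCell-def⁻¹ (half s) (half _) c d ()
localCell-def⁻¹ (half s) (def u v) c d refl = inj₂ (refl , isDef u v)
localCell-def⁻¹ (def _ _) b c d refl = inj₁ refl

localCell-carry : ∀ {s} b c d → IsDefined b → Σ Bool λ k → localCell (half s) b c d ≡ def s k
localCell-carry (def u v) c d _ = _ , refl

localCell-spawn : ∀ b {t u v} → localCell undef b (half t) (def u v) ≡ half (t xor (u xor v))
localCell-spawn b {t} {u} {v} = cong half (sum3-parity t u v)

localCell-half : ∀ {s} b c d → ¬ IsDefined b → localCell (half s) b c d ≡ half s
localCell-half undef c d _ = refl
localCell-half (half _) c d _ = refl
localCell-half (def u v) c d ¬def = ⊥-elim (¬def (isDef u v))

localCell-undef : ∀ b c d → ¬ (IsHalf c × IsDefined d) → localCell undef b c d ≡ undef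
localCell-undef b undef d _ = refl
localCell-undef b (half t) undef _ = refl
localCell-undef b (half t) (half _) _ = refl
localCell-undef b (half t) (def u v) h = ⊥-elim (h (isHalf t , isDef u v))
localCell-undef b (def _ _) d _ = refl

-- The non-local rule

module NLconditions (c : Config) where

  NLcond1-west : ∀ p → NLcond1 c p → c (west p) ≡ half true
  NLcond1-west p (c[p+W] , _ , _) = trans (cong c (sym (⊕W≡west p))) c[p+W]

  NLcond1-self : ∀ p → NLcond1 c p → ZeroOrUndef (c p)
  NLcond1-self p (_ , c[p] , _) = c[p]

  NLcond1-east : ∀ p → NLcond1 c p → ∀ i → ZeroOrUndef (c (east^ (suc i) p))
  NLcond1-east p (_ , _ , eastward) i =
    subst (ZeroOrUndef ∘ c) (+iE≡east^ p (suc i)) (eastward (suc i) (s≤s z≤n))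

  NLcond1-intro : ∀ p → c (west p) ≡ half true → ZeroOrUndef (c p) →
                  (∀ i → ZeroOrUndef (c (east^ (suc i) p))) → NLcond1 c p
  NLcond1-intro p c[w] c[p] eastward = trans (cong c (⊕W≡west p)) c[w] , c[p] , eastward′
    where
    eastward′ : ∀ i → 1 ℕ.≤ i → ZeroOrUndef (c (p +iE i))
    eastward′ (suc i) _ = subst (ZeroOrUndef ∘ c) (sym (+iE≡east^ p (suc i))) (eastward i)

  NLcond2-west : ∀ p → NLcond2 c p → c (west p) ≡ half false
  NLcond2-west p (c[p+W] , _ , _) = trans (cong c (sym (⊕W≡west p))) c[p+W]

  NLcond2-self : ∀ p → NLcond2 c p → c p ≡ half false
  NLcond2-self p (_ , c[p] , _) = c[p]

  NLcond2-far : ∀ p → NLcond2 c p → Σ ℕ λ i → c (west^ (suc i) p) ≡ half true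
  NLcond2-far p (_ , _ , suc i , _ , c[p-iW]) = i , trans (cong c (sym (+iW≡west^ p (suc i)))) c[p-iW]

  NLcond2-intro : ∀ p i → c (west p) ≡ half false → c p ≡ half false →
                  c (west^ (suc i) p) ≡ half true → NLcond2 c p
  NLcond2-intro p i c[w] c[p] c[far] =
    trans (cong c (⊕W≡west p)) c[w] , c[p] , suc i , s≤s z≤n , trans (cong c (+iW≡west^ p (suc i))) c[far]

NoPendingCarry : Config → Set
NoPendingCarry c = ∀ r → c r ≡ half true → ¬ (∀ i → ZeroOrUndef (c (east^ (suc i) r)))

module NonLocalStep {c c′ : Config} (nl : NonLocal c c′) where

  open NLconditions c

  data Rule (p : Pos) : Set where
    kept  : c′ p ≡ c p → Rule p
    rule₁ : NLcond1 c p → c′ p ≡ def false true → Rule p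
    rule₂ : ¬ NLcond1 c p → NLcond2 c p → c′ p ≡ def false false → Rule p

  -- The conditions quantify over infinitely many cells and are not decidable;
  -- the case split is only available under a double negation.
  rule : ∀ p → ¬ ¬ Rule p
  rule p k = ¬¬-excluded-middle λ
    { (yes c₁) → k (rule₁ c₁ (proj₁ (nl p) c₁))
    ; (no ¬c₁) → ¬¬-excluded-middle λ
      { (yes c₂) → k (rule₂ ¬c₁ c₂ (proj₁ (proj₂ (nl p)) ¬c₁ c₂))
      ; (no ¬c₂) → k (kept (proj₂ (proj₂ (nl p)) ¬c₁ ¬c₂)) } }

  kept-unless-ZeroOrUndef : ∀ p → ¬ ZeroOrUndef (c p) → c′ p ≡ c p
  kept-unless-ZeroOrUndef p ¬z =
    proj₂ (proj₂ (nl p)) (¬z ∘ NLcond1-self p) (¬z ∘ inj₁ ∘ NLcond2-self p)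

  def-kept : ∀ {p s k} → c p ≡ def s k → c′ p ≡ def s k
  def-kept {p} c[p] = trans (kept-unless-ZeroOrUndef p (subst (¬_ ∘ ZeroOrUndef) (sym c[p]) ¬ZeroOrUndef-def)) c[p]

  IsDefined-kept : ∀ {p} → IsDefined (c p) → IsDefined (c′ p)
  IsDefined-kept d with IsDefined⇒≡def d
  ... | s , k , c[p] = subst IsDefined (sym (def-kept c[p])) (isDef s k)

  undef-reflected : ∀ {p} → c′ p ≡ undef → c p ≡ undef
  undef-reflected {p} c′[p] = decidable-stable (c p ≟ₛ undef) λ k → rule p λ
    { (kept r) → k (trans (sym r) c′[p])
    ; (rule₁ _ r) → def≢undef (trans (sym r) c′[p])
    ; (rule₂ _ _ r) → def≢undef (trans (sym r) c′[p]) }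

  half-reflected : ∀ {p s} → c′ p ≡ half s → c p ≡ half s
  half-reflected {p} {s} c′[p] = decidable-stable (c p ≟ₛ half s) λ k → rule p λ
    { (kept r) → k (trans (sym r) c′[p])
    ; (rule₁ _ r) → def≢half (trans (sym r) c′[p])
    ; (rule₂ _ _ r) → def≢half (trans (sym r) c′[p]) }

  ZeroOrUndef-reflected : ∀ {p} → ZeroOrUndef (c′ p) → ZeroOrUndef (c p)
  ZeroOrUndef-reflected (inj₁ h) = inj₁ (half-reflected h)
  ZeroOrUndef-reflected (inj₂ u) = inj₂ (undef-reflected u)

  data DefinedOrigin (p : Pos) (s k : Bool) : Set where
    was-defined   : c p ≡ def s k → DefinedOrigin p s k
    made-by-rule₁ : NLcond1 c p → s ≡ false → k ≡ true → DefinedOrigin p s k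
    made-by-rule₂ : NLcond2 c p → s ≡ false → k ≡ false → DefinedOrigin p s k

  definedOrigin : ∀ {p s k} → c′ p ≡ def s k → ¬ ¬ DefinedOrigin p s k
  definedOrigin {p} c′[p] k = rule p λ
    { (kept r) → k (was-defined (trans (sym r) c′[p]))
    ; (rule₁ c₁ r) → k (made-by-rule₁ c₁ (def-sum (trans (sym r) c′[p])) (def-carry (trans (sym r) c′[p])))
    ; (rule₂ _ c₂ r) → k (made-by-rule₂ c₂ (def-sum (trans (sym r) c′[p])) (def-carry (trans (sym r) c′[p]))) }
    where
    def-sum : ∀ {a b s k} → def a b ≡ def s k → s ≡ a
    def-sum refl = refl
    def-carry : ∀ {a b s k} → def a b ≡ def s k → k ≡ b
    def-carry refl = refl

  -- the east neighbour of such a (1,⊥) has just been set to (0,1) by rule (i)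
  no-pending-carry : NoPendingCarry c′
  no-pending-carry r c′[r] Z = ¬ZeroOrUndef-def (subst ZeroOrUndef c′[er] (Z 0))
    where
    c′[er] : c′ (east r) ≡ def false true
    c′[er] = proj₁ (nl (east r)) (NLcond1-intro (east r) (trans (cong c (west-east r)) (half-reflected c′[r]))
               (ZeroOrUndef-reflected (Z 0))
               (λ i → subst (ZeroOrUndef ∘ c) (sym (east^-east (suc i) r)) (ZeroOrUndef-reflected (Z (suc i)))))

-- The invariant and its preservation

module Invariant (top : ℤ) where
  open Rows top public

  SumOfNorth : Config → Pos → Bool → Set
  SumOfNorth c p s = Σ Bool λ t → Σ Bool λ u → Σ Bool λ v →
    sumBit (c (north p)) ≡ just t × c (east (north p)) ≡ def u v × s ≡ t xor (u xor v)

  SumJustified : Config → Pos → Bool → Set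
  SumJustified c p s = (y p ≡ top × s ≡ false) ⊎ x p ≡ + 0 ⊎ SumOfNorth c p s

  sumOfNorth? : ∀ c p s → Dec (SumOfNorth c p s)
  sumOfNorth? c p s with sumBit (c (north p)) | c (east (north p))
  ... | nothing | _ = no λ { (_ , _ , _ , () , _) }
  ... | just t | undef = no λ { (_ , _ , _ , _ , () , _) }
  ... | just t | half _ = no λ { (_ , _ , _ , _ , () , _) }
  ... | just t | def u v with s ≟ᵇ t xor (u xor v)
  ... | yes s≡ = yes (t , u , v , refl , refl , s≡)
  ... | no s≢ = no λ { (_ , _ , _ , refl , refl , s≡) → s≢ s≡ }

  sumJustified? : ∀ c p s → Dec (SumJustified c p s)
  sumJustified? c p s = (y p ℤ.≟ top ×-dec s ≟ᵇ false) ⊎-dec (x p ℤ.≟ + 0 ⊎-dec sumOfNorth? c p s)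

  record Inv (c : Config) : Set where
    field
      above-top-undef : ∀ p → top < y p → c p ≡ undef
      east-undef : ∀ p → Posℤ (x p) → c p ≡ undef
      axis-not-half : ∀ p {s} → x p ≡ + 0 → c p ≢ half s
      top-row-occupied : ∀ p → y p ≡ top → Negℤ (x p) → c p ≢ undef
      sum-justified : ∀ p {s} → sumBit (c p) ≡ just s → SumJustified c p s
      one-has-east-neighbour : ∀ q → c q ≡ half true → Negℤ (x (east q)) → c (east q) ≢ undef
      sum-into-gap-zero : ∀ q {a k s} → Negℤ (x (east q)) → c (east (north q)) ≡ def a k →
        c (east q) ≡ undef → c (north q) ≡ half s → s xor (a xor k) ≡ false
      defined-has-west-neighbour : ∀ q {a k} → Negℤ (x (east q)) → c (east q) ≡ def a k → c q ≢ undef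
      occupied-has-defined-north : ∀ p → Negℤ (x p) → y p < top → c p ≢ undef → IsDefined (c (north p))
      half-after-gap-has-half-north : ∀ q {s} → y q < top → c (east q) ≡ half s → c q ≡ undef →
        IsHalf (c (north q))
      defined-not-before-half : ∀ q {a k s} → c q ≡ def a k → c (east q) ≢ half s
      defined-before-gap : ∀ q {a k} → Negℤ (x q) → c (east q) ≡ undef → c q ≡ def a k →
        IsDefined (c (north (east q)))
      half-before-gap : ∀ p {s} → y p < top → c p ≡ half s → c (east p) ≡ undef →
        IsDefined (c (east (north p)))
      half-half-zeroOrUndef-eastward : ∀ q {s t} → y q < top → c q ≡ half s → c (east q) ≡ half t →
        ∀ i → ZeroOrUndef (c (east^ i (east q)))
      gap-extends-east : ∀ q → c q ≢ undef → c (east q) ≡ undef → ∀ j → c (east^ (suc j) (east q)) ≡ undef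
      axis-west-gap : ∀ q → x (east q) ≡ + 0 → y q < top → c q ≡ undef → IsDefined (c (east q)) →
        ¬ IsDefined (c (north q)) × IsDefined (c (east (north q)))

  module Consequences {c : Config} (I : Inv c) where
    open Inv I

    eastward-from-defined : ∀ {a u v} → c a ≡ def u v → ∀ k →
      IsDefined (c (east^ k a)) ⊎ (c (east^ k a) ≡ undef × ∀ j → c (east^ (suc j) (east^ k a)) ≡ undef)
    eastward-from-defined {a} {u} {v} c[a] zero = inj₁ (subst IsDefined (sym c[a]) (isDef u v))
    eastward-from-defined {a} c[a] (suc k) with eastward-from-defined c[a] k
    ... | inj₂ (_ , beyond) =
      inj₂ (beyond 0 , λ j → trans (cong c (east^-east (suc j) (east^ k a))) (beyond (suc j)))
    ... | inj₁ _ with c (east^ k a) in c[r] | c (east (east^ k a)) in c[er]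
    ...   | def _ _ | def s t = inj₁ (isDef s t)
    ...   | def _ _ | half _ = ⊥-elim (defined-not-before-half (east^ k a) c[r] c[er])
    ...   | def _ _ | undef = inj₂ (refl , gap-extends-east (east^ k a) (def≢undef ∘ trans (sym c[r])) c[er])

    east-of-defined-not-half : ∀ {a u v s} → c a ≡ def u v → ∀ k → c (east^ k a) ≢ half s
    east-of-defined-not-half c[a] k c[r] with eastward-from-defined c[a] k
    ... | inj₁ d = ¬IsDefined-half (subst IsDefined c[r] d)
    ... | inj₂ (u , _) = half≢undef (trans (sym c[r]) u)

    east-of-defined-no-reentry : ∀ {a u v} → c a ≡ def u v → ∀ k →
      ¬ IsDefined (c (east^ k a)) → ¬ IsDefined (c (east^ (suc k) a))
    east-of-defined-no-reentry c[a] k ¬d d with eastward-from-defined c[a] k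
    ... | inj₁ d′ = ¬d d′
    ... | inj₂ (_ , beyond) = ¬IsDefined-undef (subst IsDefined (beyond 0) d)

    half⇒Negℤ : ∀ {p s} → c p ≡ half s → Negℤ (x p)
    half⇒Negℤ {p} c[p] with sign-trichotomy (x p)
    ... | inj₁ n = n
    ... | inj₂ (inj₁ z) = ⊥-elim (axis-not-half p z c[p])
    ... | inj₂ (inj₂ ps) = ⊥-elim (half≢undef (trans (sym c[p]) (east-undef p ps)))

    west-of-Posℤ-not-half : ∀ {p s} → Posℤ (x p) → c (west p) ≢ half s
    west-of-Posℤ-not-half {p} ps c[wp] with Posℤ-pred ps
    ... | inj₁ z = axis-not-half (west p) z c[wp]
    ... | inj₂ ps′ = half≢undef (trans (sym c[wp]) (east-undef (west p) ps′))

    top-row-not-one : ∀ {r} → y r ≡ top → c r ≢ half true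
    top-row-not-one {r} y≡ c[r] with sum-justified r (cong sumBit c[r])
    ... | inj₁ (_ , ())
    ... | inj₂ (inj₁ z) = axis-not-half r z c[r]
    ... | inj₂ (inj₂ (_ , _ , _ , σn , _ , _)) =
      case trans (cong sumBit (sym (above-top-undef (north r) (≡⇒<suc y≡)))) σn of λ ()

    half-row : ∀ {r s} → c r ≡ half s → y r < top ⊎ (y r ≡ top × s ≡ false)
    half-row {r} {s} c[r] with trichotomy (y r)
    ... | inj₁ l = inj₁ l
    ... | inj₂ (inj₂ g) = ⊥-elim (half≢undef (trans (sym c[r]) (above-top-undef r g)))
    half-row {r} {false} c[r] | inj₂ (inj₁ y≡) = inj₂ (y≡ , refl)
    half-row {r} {true} c[r] | inj₂ (inj₁ y≡) = ⊥-elim (top-row-not-one y≡ c[r])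

module NonLocalPreservesInv (top : ℤ) {c c′ : Config} (nl : NonLocal c c′) (I : Invariant.Inv top c) where
  open Invariant top
  open Inv I
  open Consequences I
  open NLconditions c
  open NonLocalStep nl

  kept-unless-west-half : ∀ p → ¬ IsHalf (c (west p)) → c′ p ≡ c p
  kept-unless-west-half p ¬h = decidable-stable (c′ p ≟ₛ c p) λ k → rule p λ
    { (kept r) → k r
    ; (rule₁ c₁ _) → ¬h (subst IsHalf (sym (NLcond1-west p c₁)) (isHalf true))
    ; (rule₂ _ c₂ _) → ¬h (subst IsHalf (sym (NLcond2-west p c₂)) (isHalf false)) }

  kept-east-of-undef : ∀ q → c q ≡ undef → c′ (east q) ≡ c (east q)
  kept-east-of-undef q c[q] =
    kept-unless-west-half (east q) (¬IsHalf-undef ∘ subst IsHalf (trans (cong c (west-east q)) c[q]))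

  rule₁-fires : ∀ r → c (west r) ≡ half true → ZeroOrUndef (c r) →
                (∀ i → ZeroOrUndef (c (east^ (suc i) r))) → c′ r ≡ def false true
  rule₁-fires r c[w] c[r] eastward = proj₁ (nl r) (NLcond1-intro r c[w] c[r] eastward)

  rule₂-fires : ∀ r i → c (west r) ≡ half false → c r ≡ half false →
                c (west^ (suc i) r) ≡ half true → c′ r ≡ def false false
  rule₂-fires r i c[w] c[r] c[far] =
    proj₁ (proj₂ (nl r)) (λ c₁ → half1≢half0 (trans (sym (NLcond1-west r c₁)) c[w])) (NLcond2-intro r i c[w] c[r] c[far])
    where
    half1≢half0 : half true ≢ half false
    half1≢half0 ()

  -- below the top row, two adjacent half cells are followed only by 0s and ⊥s
  NLcond2-blocked-by-defined : ∀ r → y r < top ⊎ y r ≡ top → NLcond2 c r → ¬ IsDefined (c (east r))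
  NLcond2-blocked-by-defined r row c₂ d with NLcond2-far r c₂ | row
  ... | i , c[far] | inj₂ y≡ = top-row-not-one (trans (y-west^ (suc i) r) y≡) c[far]
  ... | _ , _ | inj₁ y< = IsDefined⇒¬ZeroOrUndef d (subst (ZeroOrUndef ∘ c ∘ east) (east-west r)
        (half-half-zeroOrUndef-eastward (west r) y< (NLcond2-west r c₂)
          (trans (cong c (east-west r)) (NLcond2-self r c₂)) 1))

  above-top-undef′ : ∀ p → top < y p → c′ p ≡ undef
  above-top-undef′ p y> = decidable-stable (c′ p ≟ₛ undef) λ k → rule p λ
    { (kept r) → k (trans r (above-top-undef p y>))
    ; (rule₁ c₁ _) → half≢undef (trans (sym (NLcond1-west p c₁)) (above-top-undef (west p) y>))
    ; (rule₂ _ c₂ _) → half≢undef (trans (sym (NLcond2-self p c₂)) (above-top-undef p y>)) }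

  east-undef′ : ∀ p → Posℤ (x p) → c′ p ≡ undef
  east-undef′ p ps = decidable-stable (c′ p ≟ₛ undef) λ k → rule p λ
    { (kept r) → k (trans r (east-undef p ps))
    ; (rule₁ c₁ _) → west-of-Posℤ-not-half ps (NLcond1-west p c₁)
    ; (rule₂ _ c₂ _) → half≢undef (trans (sym (NLcond2-self p c₂)) (east-undef p ps)) }

  axis-not-half′ : ∀ p {s} → x p ≡ + 0 → c′ p ≢ half s
  axis-not-half′ p z = axis-not-half p z ∘ half-reflected

  top-row-occupied′ : ∀ p → y p ≡ top → Negℤ (x p) → c′ p ≢ undef
  top-row-occupied′ p y≡ n = top-row-occupied p y≡ n ∘ undef-reflected

  sumBit-kept : ∀ {q t} → sumBit (c q) ≡ just t → sumBit (c′ q) ≡ just t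
  sumBit-kept {q} {t} σ≡ = decidable-stable (sumBit≟ (c′ q) t) λ k → rule q λ
    { (kept r) → k (trans (cong sumBit r) σ≡)
    ; (rule₁ c₁ r) → k (trans (cong sumBit r) (zero-sum (NLcond1-self q c₁) σ≡))
    ; (rule₂ _ c₂ r) → k (trans (cong sumBit r) (zero-sum (inj₁ (NLcond2-self q c₂)) σ≡)) }
    where
    zero-sum : ∀ {a} → ZeroOrUndef a → sumBit a ≡ just t → just false ≡ just t
    zero-sum (inj₁ refl) σ≡ = σ≡
    zero-sum (inj₂ refl) ()

  SumJustified-kept : ∀ {p s} → SumJustified c p s → SumJustified c′ p s
  SumJustified-kept (inj₁ top-row) = inj₁ top-row
  SumJustified-kept (inj₂ (inj₁ axis)) = inj₂ (inj₁ axis)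
  SumJustified-kept (inj₂ (inj₂ (t , u , v , σn , c[en] , s≡))) =
    inj₂ (inj₂ (t , u , v , sumBit-kept σn , def-kept c[en] , s≡))

  sum-justified′ : ∀ p {s} → sumBit (c′ p) ≡ just s → SumJustified c′ p s
  sum-justified′ p {s} σ≡ = decidable-stable (sumJustified? c′ p s) λ k → rule p λ
    { (kept r) → k (SumJustified-kept (sum-justified p (trans (cong sumBit (sym r)) σ≡)))
    ; (rule₁ c₁ r) → k (set-by-rule₁ c₁ (trans (sym (cong sumBit r)) σ≡))
    ; (rule₂ _ c₂ r) → k (SumJustified-kept (sum-justified p
        (trans (cong sumBit (NLcond2-self p c₂)) (trans (sym (cong sumBit r)) σ≡)))) }
    where
    set-by-rule₁ : NLcond1 c p → just false ≡ just s → SumJustified c′ p s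
    set-by-rule₁ c₁ σ≡ with c p in c[p] | NLcond1-self p c₁
    ... | half false | _ = SumJustified-kept (sum-justified p (trans (cong sumBit c[p]) σ≡))
    ... | half true | z = ⊥-elim (¬ZeroOrUndef-one z)
    ... | def _ _ | z = ⊥-elim (¬ZeroOrUndef-def z)
    ... | undef | _ with sign-trichotomy (x p)
    ...   | inj₁ n = ⊥-elim (one-has-east-neighbour (west p) (NLcond1-west p c₁)
              (subst (Negℤ ∘ x) (sym (east-west p)) n) (trans (cong c (east-west p)) c[p]))
    ...   | inj₂ (inj₁ z) = inj₂ (inj₁ z)
    ...   | inj₂ (inj₂ ps) = ⊥-elim (west-of-Posℤ-not-half ps (NLcond1-west p c₁))

  one-has-east-neighbour′ : ∀ q → c′ q ≡ half true → Negℤ (x (east q)) → c′ (east q) ≢ undef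
  one-has-east-neighbour′ q c′[q] n = one-has-east-neighbour q (half-reflected c′[q]) n ∘ undef-reflected

  sum-into-gap-zero′ : ∀ q {a k s} → Negℤ (x (east q)) → c′ (east (north q)) ≡ def a k →
    c′ (east q) ≡ undef → c′ (north q) ≡ half s → s xor (a xor k) ≡ false
  sum-into-gap-zero′ q {a} {k} {s} n c′[enq] c′[eq] c′[nq] = decidable-stable (_ ≟ᵇ false) λ kk →
    definedOrigin c′[enq] λ
    { (was-defined r) → kk (sum-into-gap-zero q n r (undef-reflected c′[eq]) c[nq])
    ; (made-by-rule₁ c₁ refl refl) → kk (one-then-carry (trans (sym c[nq]) (west-of-east-north (NLcond1-west _ c₁))))
    ; (made-by-rule₂ c₂ refl refl) → kk (zero-then-zero (trans (sym c[nq]) (west-of-east-north (NLcond2-west _ c₂)))) }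
    where
    c[nq] = half-reflected c′[nq]
    west-of-east-north : ∀ {st} → c (west (east (north q))) ≡ st → c (north q) ≡ st
    west-of-east-north = trans (cong c (sym (west-east (north q))))
    one-then-carry : half s ≡ half true → s xor (false xor true) ≡ false
    one-then-carry refl = refl
    zero-then-zero : half s ≡ half false → s xor (false xor false) ≡ false
    zero-then-zero refl = refl

  defined-has-west-neighbour′ : ∀ q {a k} → Negℤ (x (east q)) → c′ (east q) ≡ def a k → c′ q ≢ undef
  defined-has-west-neighbour′ q n c′[eq] c′[q] =
    defined-has-west-neighbour q n (trans (sym (kept-east-of-undef q c[q])) c′[eq]) c[q]
    where
    c[q] = undef-reflected c′[q]

  occupied-reflected : ∀ p → Negℤ (x p) → c′ p ≢ undef → c p ≢ undef
  occupied-reflected p n c′[p]≢ c[p] = rule p λ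
    { (kept r) → c′[p]≢ (trans r c[p])
    ; (rule₁ c₁ _) → one-has-east-neighbour (west p) (NLcond1-west p c₁)
        (subst (Negℤ ∘ x) (sym (east-west p)) n) (trans (cong c (east-west p)) c[p])
    ; (rule₂ _ c₂ _) → half≢undef (trans (sym (NLcond2-self p c₂)) c[p]) }

  occupied-has-defined-north′ : ∀ p → Negℤ (x p) → y p < top → c′ p ≢ undef → IsDefined (c′ (north p))
  occupied-has-defined-north′ p n y< c′[p]≢ =
    IsDefined-kept (occupied-has-defined-north p n y< (occupied-reflected p n c′[p]≢))

  half-after-gap-has-half-north′ : ∀ q {s} → y q < top → c′ (east q) ≡ half s → c′ q ≡ undef →
    IsHalf (c′ (north q))
  half-after-gap-has-half-north′ q y< c′[eq] c′[q] = decidable-stable (isHalf? _) λ k → rule (north q) λ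
    { (kept r) → k (subst IsHalf (sym r) (half-after-gap-has-half-north q y< c[eq] (undef-reflected c′[q])))
    ; (rule₁ c₁ _) → IsDefined⇒¬ZeroOrUndef c[enq]-defined (NLcond1-east (north q) c₁ 0)
    ; (rule₂ _ c₂ _) → NLcond2-blocked-by-defined (north q) (<⇒suc<⊎suc≡ y<) c₂ c[enq]-defined }
    where
    c[eq] = half-reflected c′[eq]
    c[enq]-defined : IsDefined (c (east (north q)))
    c[enq]-defined = occupied-has-defined-north (east q) (half⇒Negℤ c[eq]) y< (half≢undef ∘ trans (sym c[eq]))

  defined-not-before-half′ : ∀ q {a k s} → c′ q ≡ def a k → c′ (east q) ≢ half s
  defined-not-before-half′ q {s = s} c′[q] c′[eq] = definedOrigin c′[q] λ
    { (was-defined r) → defined-not-before-half q r c[eq]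
    ; (made-by-rule₁ c₁ _ _) → by-rule₁ c₁
    ; (made-by-rule₂ c₂ _ _) → by-rule₂ c₂ }
    where
    c[eq] = half-reflected c′[eq]
    fired-at-east : ∀ i → c q ≡ half false → s ≡ false → c (west^ (suc i) q) ≡ half true → ⊥
    fired-at-east i c[q] refl c[far] = def≢half (trans (sym (rule₂-fires (east q) (suc i)
      (trans (cong c (west-east q)) c[q]) c[eq] (trans (cong c (west^-east (suc i) q)) c[far]))) c′[eq])
    by-rule₁ : NLcond1 c q → ⊥
    by-rule₁ c₁ with c q in c[q] | NLcond1-self q c₁
    ... | half true | z = ¬ZeroOrUndef-one z
    ... | def _ _ | z = ¬ZeroOrUndef-def z
    ... | half false | _ = fired-at-east 0 c[q]
          (ZeroOrUndef-half⇒false (subst ZeroOrUndef c[eq] (NLcond1-east q c₁ 0))) (NLcond1-west q c₁)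
    ... | undef | _ = one-has-east-neighbour (west q) (NLcond1-west q c₁)
          (subst (Negℤ ∘ x) (sym (east-west q)) (Negℤ-suc⁻¹ (half⇒Negℤ c[eq]))) (trans (cong c (east-west q)) c[q])
    by-rule₂ : NLcond2 c q → ⊥
    by-rule₂ c₂ with NLcond2-far q c₂ | half-row (NLcond2-self q c₂)
    ... | i , c[far] | inj₂ (y≡ , _) = top-row-not-one (trans (y-west^ (suc i) q) y≡) c[far]
    ... | i , c[far] | inj₁ y< = fired-at-east i (NLcond2-self q c₂)
          (ZeroOrUndef-half⇒false (subst ZeroOrUndef c[eq] (subst (ZeroOrUndef ∘ c ∘ east) (east-west q)
            (half-half-zeroOrUndef-eastward (west q) y< (NLcond2-west q c₂)
              (trans (cong c (east-west q)) (NLcond2-self q c₂)) 1))))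
          c[far]

  defined-before-gap′ : ∀ q {a k} → Negℤ (x q) → c′ (east q) ≡ undef → c′ q ≡ def a k →
    IsDefined (c′ (north (east q)))
  defined-before-gap′ q n c′[eq] c′[q] = decidable-stable (isDefined? _) λ k → definedOrigin c′[q] λ
    { (was-defined r) → k (IsDefined-kept (defined-before-gap q n c[eq] r))
    ; (made-by-rule₁ c₁ _ _) → by-rule₁ c₁ k
    ; (made-by-rule₂ c₂ _ _) → let (i , c[far]) = NLcond2-far q c₂ in k (zero-then-gap i (NLcond2-self q c₂) c[far]) }
    where
    c[eq] = undef-reflected c′[eq]
    zero-then-gap : ∀ i → c q ≡ half false → c (west^ (suc i) q) ≡ half true → IsDefined (c′ (north (east q)))
    zero-then-gap i c[q] c[far] with half-row c[q]
    ... | inj₁ y< = IsDefined-kept (half-before-gap q y< c[q] c[eq])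
    ... | inj₂ (y≡ , _) = ⊥-elim (top-row-not-one (trans (y-west^ (suc i) q) y≡) c[far])
    by-rule₁ : NLcond1 c q → ¬ IsDefined (c′ (north (east q))) → ⊥
    by-rule₁ c₁ k with c q in c[q] | NLcond1-self q c₁
    ... | half true | z = ¬ZeroOrUndef-one z
    ... | def _ _ | z = ¬ZeroOrUndef-def z
    ... | half false | _ = k (zero-then-gap 0 c[q] (NLcond1-west q c₁))
    ... | undef | _ = one-has-east-neighbour (west q) (NLcond1-west q c₁)
          (subst (Negℤ ∘ x) (sym (east-west q)) n) (trans (cong c (east-west q)) c[q])

  half-before-gap′ : ∀ p {s} → y p < top → c′ p ≡ half s → c′ (east p) ≡ undef →
    IsDefined (c′ (east (north p)))
  half-before-gap′ p y< c′[p] c′[ep] =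
    IsDefined-kept (half-before-gap p y< (half-reflected c′[p]) (undef-reflected c′[ep]))

  -- west of a surviving (0,⊥) whose west neighbour is half there is no (1,⊥)
  -- that could reach it, since otherwise rule (i) or (ii) would have fired
  surviving-half-no-one-west : ∀ r {t} → c′ r ≡ half t → IsHalf (c (west r)) →
    (∀ i → ZeroOrUndef (c (east^ i r))) → ∀ d → c (west^ (suc d) r) ≢ half true
  surviving-half-no-one-west r c′[r] west-half eastward = go west-half
    where
    not-one : c (west r) ≢ half true
    not-one c[w] = def≢half (trans (sym (rule₁-fires r c[w] (eastward 0) (eastward ∘ suc))) c′[r])
    c[r] : c r ≡ half false
    c[r] = trans (half-reflected c′[r])
                 (cong half (ZeroOrUndef-half⇒false (subst ZeroOrUndef (half-reflected c′[r]) (eastward 0))))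
    go : IsHalf (c (west r)) → ∀ d → c (west^ (suc d) r) ≢ half true
    go _ zero = not-one
    go h (suc d) c[far] with c (west r) in c[w] | h
    ... | .(half true) | isHalf true = not-one c[w]
    ... | .(half false) | isHalf false = def≢half (trans (sym (rule₂-fires r (suc d) c[w] c[r] c[far])) c′[r])

  half-half-zeroOrUndef-eastward′ : ∀ q {s t} → y q < top → c′ q ≡ half s → c′ (east q) ≡ half t →
    ∀ i → ZeroOrUndef (c′ (east^ i (east q)))
  half-half-zeroOrUndef-eastward′ q y< c′[q] c′[eq] zero =
    inj₁ (trans c′[eq] (cong half (ZeroOrUndef-half⇒false (subst ZeroOrUndef (half-reflected c′[eq]) (eastward 0)))))
    where
    eastward = half-half-zeroOrUndef-eastward q y< (half-reflected c′[q]) (half-reflected c′[eq])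
  half-half-zeroOrUndef-eastward′ q {s} y< c′[q] c′[eq] (suc j) =
    decidable-stable (zeroOrUndef? _) λ k → rule r λ
    { (kept r≡) → k (subst ZeroOrUndef (sym r≡) (eastward (suc j)))
    ; (rule₁ c₁ _) → ¬ZeroOrUndef-one (subst ZeroOrUndef
        (trans (cong c (sym (west-east (east^ j (east q))))) (NLcond1-west r c₁)) (eastward j))
    ; (rule₂ _ c₂ _) → by-rule₂ c₂ }
    where
    eastward = half-half-zeroOrUndef-eastward q y< (half-reflected c′[q]) (half-reflected c′[eq])
    r = east^ (suc j) (east q)
    by-rule₂ : NLcond2 c r → ⊥
    by-rule₂ c₂ with NLcond2-far r c₂
    ... | m , c[far] with m ℕ.≤? j
    ...   | yes m≤j = ¬ZeroOrUndef-one (subst ZeroOrUndef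
            (trans (cong c (sym (west^-east^-≤ (suc m) (suc j) (east q) (s≤s m≤j)))) c[far]) (eastward (j ℕ.∸ m)))
    ...   | no m≰j with ℕP.≰⇒> m≰j
    ...     | j<m = surviving-half-no-one-west (east q) c′[eq]
                (subst IsHalf (sym (trans (cong c (west-east q)) (half-reflected c′[q]))) (isHalf s)) eastward
                (m ℕ.∸ suc j)
                (trans (cong c (sym (trans (west^-east^-≥ (suc m) (suc j) (east q) (ℕP.<⇒≤ (s≤s j<m)))
                                           (cong (λ d → west^ d (east q)) (ℕP.+-∸-assoc 1 j<m))))) c[far])

  gap-extends-east′ : ∀ q → c′ q ≢ undef → c′ (east q) ≡ undef → ∀ j → c′ (east^ (suc j) (east q)) ≡ undef
  gap-extends-east′ q c′[q]≢ c′[eq] j = decidable-stable (_ ≟ₛ undef) λ k → rule q λ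
    { (kept r) → k (beyond-occupied (c′[q]≢ ∘ trans r))
    ; (rule₁ c₁ _) → by-rule₁ c₁ k
    ; (rule₂ _ c₂ _) → k (beyond-occupied (half≢undef ∘ trans (sym (NLcond2-self q c₂)))) }
    where
    c[eq] = undef-reflected c′[eq]
    beyond-occupied : c q ≢ undef → c′ (east^ (suc j) (east q)) ≡ undef
    beyond-occupied c[q]≢ = trans (kept-unless-west-half (east^ (suc j) (east q))
        (¬IsHalf-undef ∘ subst IsHalf (trans (cong c (west-east (east^ j (east q)))) (gap j)))) (beyond j)
      where
      beyond = gap-extends-east q c[q]≢ c[eq]
      gap : ∀ i → c (east^ i (east q)) ≡ undef
      gap zero = c[eq]
      gap (suc i) = beyond i
    by-rule₁ : NLcond1 c q → ¬ c′ (east^ (suc j) (east q)) ≡ undef → ⊥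
    by-rule₁ c₁ k with c q in c[q] | NLcond1-self q c₁
    ... | half true | z = ¬ZeroOrUndef-one z
    ... | def _ _ | z = ¬ZeroOrUndef-def z
    ... | half false | _ = k (beyond-occupied (half≢undef ∘ trans (sym c[q])))
    ... | undef | _ with sign-trichotomy (x q)
    ...   | inj₁ n = one-has-east-neighbour (west q) (NLcond1-west q c₁)
              (subst (Negℤ ∘ x) (sym (east-west q)) n) (trans (cong c (east-west q)) c[q])
    ...   | inj₂ nonNeg = k (east-undef′ _ (Posℤ-east^ j (east q) (inj₂ (nonNeg-suc nonNeg))))

  axis-west-gap′ : ∀ q → x (east q) ≡ + 0 → y q < top → c′ q ≡ undef → IsDefined (c′ (east q)) →
    ¬ IsDefined (c′ (north q)) × IsDefined (c′ (east (north q)))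
  axis-west-gap′ q z y< c′[q] d = north-not-defined , IsDefined-kept (proj₂ gap)
    where
    c[q] = undef-reflected c′[q]
    gap = axis-west-gap q z y< c[q] (subst IsDefined (kept-east-of-undef q c[q]) d)
    north-not-defined : ¬ IsDefined (c′ (north q))
    north-not-defined dn = let (_ , _ , c′[nq]) = IsDefined⇒≡def dn in definedOrigin c′[nq] λ
      { (was-defined r) → proj₁ gap (subst IsDefined (sym r) (isDef _ _))
      ; (made-by-rule₁ c₁ _ _) → IsDefined⇒¬ZeroOrUndef (proj₂ gap) (NLcond1-east (north q) c₁ 0)
      ; (made-by-rule₂ c₂ _ _) → NLcond2-blocked-by-defined (north q) (<⇒suc<⊎suc≡ y<) c₂ (proj₂ gap) }

  inv′ : Inv c′
  inv′ = record
    { above-top-undef = above-top-undef′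
    ; east-undef = east-undef′
    ; axis-not-half = axis-not-half′
    ; top-row-occupied = top-row-occupied′
    ; sum-justified = sum-justified′
    ; one-has-east-neighbour = one-has-east-neighbour′
    ; sum-into-gap-zero = sum-into-gap-zero′
    ; defined-has-west-neighbour = defined-has-west-neighbour′
    ; occupied-has-defined-north = occupied-has-defined-north′
    ; half-after-gap-has-half-north = half-after-gap-has-half-north′
    ; defined-not-before-half = defined-not-before-half′
    ; defined-before-gap = defined-before-gap′
    ; half-before-gap = half-before-gap′
    ; half-half-zeroOrUndef-eastward = half-half-zeroOrUndef-eastward′
    ; gap-extends-east = gap-extends-east′
    ; axis-west-gap = axis-west-gap′
    }

module LocalPreservesInv (top : ℤ) {c′ d : Config} (local : ∀ p → d p ≡ localRule c′ p)
                         (I : Invariant.Inv top c′) (no-carry : NoPendingCarry c′) where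
  open Invariant top
  open Inv I
  open Consequences I

  localCellAt : Pos → State → State
  localCellAt p a = localCell a (c′ (east p)) (c′ (north p)) (c′ (east (north p)))

  local′ : ∀ p → d p ≡ localCellAt p (c′ p)
  local′ p = trans (local p) (trans
    (cong (λ a → localCell (c′ p) (c′ a) (c′ (p ⊕ N)) (c′ ((p ⊕ N) ⊕ E))) (⊕E≡east p))
    (cong₂ (λ a b → localCell (c′ p) (c′ (east p)) (c′ a) (c′ b)) (⊕N≡north p) (⊕N⊕E≡east-north p)))

  undef⁻¹ : ∀ {p} → d p ≡ undef → c′ p ≡ undef × ¬ (IsHalf (c′ (north p)) × IsDefined (c′ (east (north p))))
  undef⁻¹ {p} d[p] = localCell-undef⁻¹ _ _ _ _ (trans (sym (local′ p)) d[p])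

  half⁻¹ : ∀ {p s} → d p ≡ half s → (c′ p ≡ half s × ¬ IsDefined (c′ (east p))) ⊎
    (c′ p ≡ undef × Σ Bool λ t → Σ Bool λ u → Σ Bool λ v →
      c′ (north p) ≡ half t × c′ (east (north p)) ≡ def u v × s ≡ t xor (u xor v))
  half⁻¹ {p} d[p] = localCell-half⁻¹ _ _ _ _ (trans (sym (local′ p)) d[p])

  def⁻¹ : ∀ {p s k} → d p ≡ def s k → c′ p ≡ def s k ⊎ (c′ p ≡ half s × IsDefined (c′ (east p)))
  def⁻¹ {p} d[p] = localCell-def⁻¹ _ _ _ _ (trans (sym (local′ p)) d[p])

  def-stays : ∀ {p s k} → c′ p ≡ def s k → d p ≡ def s k
  def-stays {p} c′[p] = trans (local′ p) (cong (localCellAt p) c′[p])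

  half-gets-carry : ∀ {p s} → c′ p ≡ half s → IsDefined (c′ (east p)) → Σ Bool λ k → d p ≡ def s k
  half-gets-carry {p} c′[p] de = let (k , r) = localCell-carry (c′ (east p)) (c′ (north p)) (c′ (east (north p))) de in
    k , trans (local′ p) (trans (cong (localCellAt p) c′[p]) r)

  spawns : ∀ {p t u v} → c′ p ≡ undef → c′ (north p) ≡ half t → c′ (east (north p)) ≡ def u v →
    d p ≡ half (t xor (u xor v))
  spawns {p} {t} {u} {v} c′[p] c′[np] c′[enp] = trans (local′ p)
    (trans (cong₂ (λ a b → localCell a (c′ (east p)) b (c′ (east (north p)))) c′[p] c′[np])
           (trans (cong (localCell undef (c′ (east p)) (half t)) c′[enp]) (localCell-spawn (c′ (east p)) {t} {u} {v})))

  half-stays : ∀ {p s} → c′ p ≡ half s → ¬ IsDefined (c′ (east p)) → d p ≡ half s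
  half-stays {p} c′[p] ¬de = trans (local′ p) (trans (cong (localCellAt p) c′[p]) (localCell-half _ _ _ ¬de))

  undef-stays : ∀ {p} → c′ p ≡ undef → ¬ (IsHalf (c′ (north p)) × IsDefined (c′ (east (north p)))) → d p ≡ undef
  undef-stays {p} c′[p] ¬spawn = trans (local′ p) (trans (cong (localCellAt p) c′[p]) (localCell-undef _ _ _ ¬spawn))

  IsDefined-stays : ∀ {p} → IsDefined (c′ p) → IsDefined (d p)
  IsDefined-stays de = let (s , k , c′[p]) = IsDefined⇒≡def de in subst IsDefined (sym (def-stays c′[p])) (isDef s k)

  sumBit-stays : ∀ {p t} → sumBit (c′ p) ≡ just t → sumBit (d p) ≡ just t
  sumBit-stays {p} σ≡ with c′ p in c′[p]
  ... | def _ _ = trans (cong sumBit (def-stays c′[p])) σ≡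
  ... | half _ with isDefined? (c′ (east p))
  ...   | yes de = trans (cong sumBit (proj₂ (half-gets-carry c′[p] de))) σ≡
  ...   | no ¬de = trans (cong sumBit (half-stays c′[p] ¬de)) σ≡

  sumBit-reflected : ∀ {p t s} → sumBit (c′ p) ≡ just t → sumBit (d p) ≡ just s → sumBit (c′ p) ≡ just s
  sumBit-reflected σ′ σ = trans σ′ (trans (sym (sumBit-stays σ′)) σ)

  undef⇒¬IsDefined : ∀ {p} → c′ p ≡ undef → ¬ IsDefined (d p)
  undef⇒¬IsDefined {p} c′[p] dd with IsDefined⇒≡def dd
  ... | _ , _ , d[p] with def⁻¹ d[p]
  ...   | inj₁ r = def≢undef (trans (sym r) c′[p])
  ...   | inj₂ (r , _) = half≢undef (trans (sym r) c′[p])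

  above-top-undef′ : ∀ p → top < y p → d p ≡ undef
  above-top-undef′ p y> = undef-stays (above-top-undef p y>)
    λ (h , _) → ¬IsHalf-undef (subst IsHalf (above-top-undef (north p) (>⇒<suc y>)) h)

  east-undef′ : ∀ p → Posℤ (x p) → d p ≡ undef
  east-undef′ p ps = undef-stays (east-undef p ps)
    λ (_ , de) → ¬IsDefined-undef (subst IsDefined (east-undef (east (north p)) (nonNeg-suc (inj₂ ps))) de)

  axis-not-half′ : ∀ p {s} → x p ≡ + 0 → d p ≢ half s
  axis-not-half′ p z d[p] with half⁻¹ d[p]
  ... | inj₁ (c′[p] , _) = axis-not-half p z c′[p]
  ... | inj₂ (_ , _ , _ , _ , _ , c′[enp] , _) =
    def≢undef (trans (sym c′[enp]) (east-undef (east (north p)) (nonNeg-suc (inj₁ z))))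

  top-row-occupied′ : ∀ p → y p ≡ top → Negℤ (x p) → d p ≢ undef
  top-row-occupied′ p y≡ n = top-row-occupied p y≡ n ∘ proj₁ ∘ undef⁻¹

  SumJustified-stays : ∀ {p s} → SumJustified c′ p s → SumJustified d p s
  SumJustified-stays (inj₁ top-row) = inj₁ top-row
  SumJustified-stays (inj₂ (inj₁ axis)) = inj₂ (inj₁ axis)
  SumJustified-stays (inj₂ (inj₂ (t , u , v , σn , c′[en] , s≡))) =
    inj₂ (inj₂ (t , u , v , sumBit-stays σn , def-stays c′[en] , s≡))

  sum-justified′ : ∀ p {s} → sumBit (d p) ≡ just s → SumJustified d p s
  sum-justified′ p {s} σ≡ with c′ p in c′[p]
  ... | def _ _ = SumJustified-stays (sum-justified p (sumBit-reflected (cong sumBit c′[p]) σ≡))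
  ... | half _ = SumJustified-stays (sum-justified p (sumBit-reflected (cong sumBit c′[p]) σ≡))
  ... | undef = spawned (d p) refl σ≡
    where
    spawned : ∀ a → d p ≡ a → sumBit a ≡ just s → SumJustified d p s
    spawned (def _ _) d[p] _ with def⁻¹ d[p]
    ... | inj₁ r = ⊥-elim (def≢undef (trans (sym r) c′[p]))
    ... | inj₂ (r , _) = ⊥-elim (half≢undef (trans (sym r) c′[p]))
    spawned (half _) d[p] refl with half⁻¹ d[p]
    ... | inj₁ (r , _) = ⊥-elim (half≢undef (trans (sym r) c′[p]))
    ... | inj₂ (_ , t , u , v , c′[np] , c′[enp] , s≡) =
      inj₂ (inj₂ (t , u , v , sumBit-stays (cong sumBit c′[np]) , def-stays c′[enp] , s≡))

  one-has-east-neighbour′ : ∀ q → d q ≡ half true → Negℤ (x (east q)) → d (east q) ≢ undef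
  one-has-east-neighbour′ q d[q] n d[eq] with half⁻¹ d[q]
  ... | inj₁ (c′[q] , _) = one-has-east-neighbour q c′[q] n (proj₁ (undef⁻¹ d[eq]))
  ... | inj₂ (_ , _ , _ , _ , c′[nq] , c′[enq] , s≡) =
    true≢false (trans s≡ (sum-into-gap-zero q n c′[enq] (proj₁ (undef⁻¹ d[eq])) c′[nq]))
    where
    true≢false : true ≢ false
    true≢false ()

  sum-into-gap-zero′ : ∀ q {a k s} → Negℤ (x (east q)) → d (east (north q)) ≡ def a k →
    d (east q) ≡ undef → d (north q) ≡ half s → s xor (a xor k) ≡ false
  sum-into-gap-zero′ q n d[enq] d[eq] d[nq] with def⁻¹ d[enq] | undef⁻¹ d[eq]
  ... | inj₂ (c′[enq] , de) | (_ , ¬spawn) = ⊥-elim (¬spawn (subst IsHalf (sym c′[enq]) (isHalf _) , de))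
  ... | inj₁ c′[enq] | (c′[eq] , _) with half⁻¹ d[nq]
  ...   | inj₁ (c′[nq] , _) = sum-into-gap-zero q n c′[enq] c′[eq] c′[nq]
  ...   | inj₂ (c′[nq] , _) = ⊥-elim (defined-has-west-neighbour (north q) n c′[enq] c′[nq])

  defined-has-west-neighbour′ : ∀ q {a k} → Negℤ (x (east q)) → d (east q) ≡ def a k → d q ≢ undef
  defined-has-west-neighbour′ q n d[eq] d[q] with undef⁻¹ d[q] | def⁻¹ d[eq]
  ... | (c′[q] , _) | inj₁ c′[eq] = defined-has-west-neighbour q n c′[eq] c′[q]
  ... | (c′[q] , ¬spawn) | inj₂ (c′[eq] , _) with trichotomy (y q)
  ...   | inj₁ y< = ¬spawn (half-after-gap-has-half-north q y< c′[eq] c′[q] ,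
                            occupied-has-defined-north (east q) n y< (half≢undef ∘ trans (sym c′[eq])))
  ...   | inj₂ (inj₁ y≡) = top-row-occupied q y≡ (Negℤ-suc⁻¹ n) c′[q]
  ...   | inj₂ (inj₂ y>) = half≢undef (trans (sym c′[eq]) (above-top-undef (east q) y>))

  occupied-has-defined-north′ : ∀ p → Negℤ (x p) → y p < top → d p ≢ undef → IsDefined (d (north p))
  occupied-has-defined-north′ p n y< d[p]≢ = from (d p) refl
    where
    below : c′ p ≢ undef → IsDefined (d (north p))
    below = IsDefined-stays ∘ occupied-has-defined-north p n y<
    from : ∀ a → d p ≡ a → IsDefined (d (north p))
    from undef d[p] = ⊥-elim (d[p]≢ d[p])
    from (half s) d[p] with half⁻¹ d[p]
    ... | inj₁ (c′[p] , _) = below (half≢undef ∘ trans (sym c′[p]))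
    ... | inj₂ (_ , t , u , v , c′[np] , c′[enp] , _) =
      subst IsDefined (sym (proj₂ (half-gets-carry c′[np] (subst IsDefined (sym c′[enp]) (isDef u v))))) (isDef t _)
    from (def s k) d[p] with def⁻¹ d[p]
    ... | inj₁ c′[p] = below (def≢undef ∘ trans (sym c′[p]))
    ... | inj₂ (c′[p] , _) = below (half≢undef ∘ trans (sym c′[p]))

  half-after-gap-has-half-north′ : ∀ q {s} → y q < top → d (east q) ≡ half s → d q ≡ undef →
    IsHalf (d (north q))
  half-after-gap-has-half-north′ q y< d[eq] d[q] with undef⁻¹ d[q] | half⁻¹ d[eq]
  ... | (c′[q] , ¬spawn) | inj₁ (c′[eq] , _) = ⊥-elim (¬spawn (half-after-gap-has-half-north q y< c′[eq] c′[q] ,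
        occupied-has-defined-north (east q) (half⇒Negℤ c′[eq]) y< (half≢undef ∘ trans (sym c′[eq]))))
  ... | (c′[q] , _) | inj₂ (_ , t , u , v , c′[neq] , _ , _) = from (c′ (north q)) refl
    where
    from : ∀ a → c′ (north q) ≡ a → IsHalf (d (north q))
    from (def _ _) c′[nq] = ⊥-elim (defined-not-before-half (north q) c′[nq] c′[neq])
    from (half a) c′[nq] = subst IsHalf (sym (half-stays c′[nq] (¬IsDefined-half ∘ subst IsDefined c′[neq]))) (isHalf a)
    from undef c′[nq] with <⇒suc<⊎suc≡ y<
    ... | inj₂ y≡ = ⊥-elim (top-row-occupied (north q) y≡ (Negℤ-suc⁻¹ (half⇒Negℤ c′[neq])) c′[nq])
    ... | inj₁ y<′ with IsHalf⇒≡half (half-after-gap-has-half-north (north q) y<′ c′[neq] c′[nq])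
                      | IsDefined⇒≡def (occupied-has-defined-north (east (north q)) (half⇒Negℤ c′[neq]) y<′
                                          (half≢undef ∘ trans (sym c′[neq])))
    ...   | (_ , c′[nnq]) | (_ , _ , c′[ennq]) = subst IsHalf (sym (spawns c′[nq] c′[nnq] c′[ennq])) (isHalf _)

  defined-not-before-half′ : ∀ q {a k s} → d q ≡ def a k → d (east q) ≢ half s
  defined-not-before-half′ q d[q] d[eq] with half⁻¹ d[eq] | def⁻¹ d[q]
  ... | inj₁ (c′[eq] , _) | inj₁ c′[q] = defined-not-before-half q c′[q] c′[eq]
  ... | inj₁ (c′[eq] , _) | inj₂ (_ , de) = ¬IsDefined-half (subst IsDefined c′[eq] de)
  ... | inj₂ (c′[eq] , _ , _ , _ , c′[neq] , _ , _) | inj₁ c′[q] = ¬IsDefined-half (subst IsDefined c′[neq]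
        (defined-before-gap q (Negℤ-suc⁻¹ (half⇒Negℤ c′[neq])) c′[eq] c′[q]))
  ... | inj₂ (c′[eq] , _) | inj₂ (_ , de) = ¬IsDefined-undef (subst IsDefined c′[eq] de)

  defined-before-gap′ : ∀ q {a k} → Negℤ (x q) → d (east q) ≡ undef → d q ≡ def a k →
    IsDefined (d (north (east q)))
  defined-before-gap′ q n d[eq] d[q] with undef⁻¹ d[eq] | def⁻¹ d[q]
  ... | (c′[eq] , _) | inj₁ c′[q] = IsDefined-stays (defined-before-gap q n c′[eq] c′[q])
  ... | (c′[eq] , _) | inj₂ (_ , de) = ⊥-elim (¬IsDefined-undef (subst IsDefined c′[eq] de))

  half-before-gap′ : ∀ p {s} → y p < top → d p ≡ half s → d (east p) ≡ undef → IsDefined (d (east (north p)))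
  half-before-gap′ p y< d[p] d[ep] with undef⁻¹ d[ep] | half⁻¹ d[p]
  ... | (c′[ep] , _) | inj₁ (c′[p] , _) = IsDefined-stays (half-before-gap p y< c′[p] c′[ep])
  ... | _ | inj₂ (_ , _ , u , v , _ , c′[enp] , _) = IsDefined-stays (subst IsDefined (sym c′[enp]) (isDef u v))

  -- below a defined cell, a row of 0s and ⊥s spawns nothing: rule (ii) would
  -- need a (s,⊥) in the row above, which cannot follow a defined cell
  ZeroOrUndef-stays-below-defined : ∀ q → IsDefined (c′ (north (east q))) →
    (∀ i → ZeroOrUndef (c′ (east^ i (east q)))) → ∀ i → ZeroOrUndef (d (east^ i (east q)))
  ZeroOrUndef-stays-below-defined q de eastward i with eastward i | IsDefined⇒≡def de
  ... | inj₁ c′[r] | _ = inj₁ (half-stays c′[r] (λ de′ → IsDefined⇒¬ZeroOrUndef de′ (eastward (suc i))))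
  ... | inj₂ c′[r] | (_ , _ , c′[neq]) = inj₂ (undef-stays c′[r] λ (h , _) → let (_ , c′[nr]) = IsHalf⇒≡half h in
        east-of-defined-not-half c′[neq] i (trans (cong c′ (sym (north-east^ i (east q)))) c′[nr]))

  half-half-zeroOrUndef-eastward′ : ∀ q {s t} → y q < top → d q ≡ half s → d (east q) ≡ half t →
    ∀ i → ZeroOrUndef (d (east^ i (east q)))
  half-half-zeroOrUndef-eastward′ q y< d[q] d[eq] with half⁻¹ d[eq]
  ... | inj₂ (_ , _ , _ , _ , c′[neq] , _ , _) with half⁻¹ d[q]
  ...   | inj₁ (c′[q] , _) = ⊥-elim (defined-not-before-half (north q)
          (proj₂ (proj₂ (IsDefined⇒≡def (occupied-has-defined-north q (half⇒Negℤ c′[q]) y< (half≢undef ∘ trans (sym c′[q]))))))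
          c′[neq])
  ...   | inj₂ (_ , _ , _ , _ , _ , c′[enq] , _) = ⊥-elim (def≢half (trans (sym c′[enq]) c′[neq]))
  half-half-zeroOrUndef-eastward′ q {t = t} y< d[q] d[eq] | inj₁ (c′[eq] , ¬de) =
    ZeroOrUndef-stays-below-defined q
      (occupied-has-defined-north (east q) (half⇒Negℤ c′[eq]) y< (half≢undef ∘ trans (sym c′[eq]))) eastward
    where
    beyond : ∀ i → ZeroOrUndef (c′ (east^ (suc i) (east q)))
    beyond i with c′ (east (east q)) in c′[eeq]
    ... | def a k = ⊥-elim (¬de (isDef a k))
    ... | half _ = subst (ZeroOrUndef ∘ c′) (east^-east i (east q))
                   (half-half-zeroOrUndef-eastward (east q) y< c′[eq] c′[eeq] i)
    ... | undef = inj₂ (trans (cong c′ (sym (east^-east i (east q)))) (past-gap i))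
      where
      past-gap : ∀ i → c′ (east^ i (east (east q))) ≡ undef
      past-gap zero = c′[eeq]
      past-gap (suc j) = gap-extends-east (east q) (half≢undef ∘ trans (sym c′[eq])) c′[eeq] j
    eastward : ∀ i → ZeroOrUndef (c′ (east^ i (east q)))
    eastward (suc i) = beyond i
    eastward zero with half⁻¹ d[q]
    ... | inj₁ (c′[q] , _) = half-half-zeroOrUndef-eastward q y< c′[q] c′[eq] 0
    ... | inj₂ _ = not-one t c′[eq]
      where
      not-one : ∀ t → c′ (east q) ≡ half t → ZeroOrUndef (c′ (east q))
      not-one false c′[eq] = inj₁ c′[eq]
      not-one true c′[eq] = ⊥-elim (no-carry (east q) c′[eq] beyond)

  row-below-defined-empty : ∀ q {a k} → y q < top → c′ (east (north q)) ≡ def a k → c′ (east q) ≡ undef →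
    ∀ m → c′ (east^ m (east q)) ≡ undef
  row-below-defined-empty q y< c′[enq] c′[eq] zero = c′[eq]
  row-below-defined-empty q y< c′[enq] c′[eq] (suc m) = next (c′ (east z)) refl
    where
    z = east^ m (east q)
    c′[z] = row-below-defined-empty q y< c′[enq] c′[eq] m
    z< : y z < top
    z< = subst (_< top) (sym (y-east^ m (east q))) y<
    north-z : ∀ {a} → c′ (north z) ≡ a → c′ (east^ m (north (east q))) ≡ a
    north-z = trans (cong c′ (sym (north-east^ m (east q))))
    next : ∀ a → c′ (east z) ≡ a → c′ (east z) ≡ undef
    next undef c′[ez] = c′[ez]
    next (half _) c′[ez] = let (_ , c′[nz]) = IsHalf⇒≡half (half-after-gap-has-half-north z z< c′[ez] c′[z]) in
      ⊥-elim (east-of-defined-not-half c′[enq] m (north-z c′[nz]))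
    next (def a k) c′[ez] with sign-trichotomy (x (east z))
    ... | inj₁ n = ⊥-elim (defined-has-west-neighbour z n c′[ez] c′[z])
    ... | inj₂ (inj₂ ps) = ⊥-elim (def≢undef (trans (sym c′[ez]) (east-undef (east z) ps)))
    ... | inj₂ (inj₁ z≡0) = let (¬dn , den) = axis-west-gap z z≡0 z< c′[z] (subst IsDefined (sym c′[ez]) (isDef a k)) in
      ⊥-elim (east-of-defined-no-reentry c′[enq] m (¬dn ∘ subst IsDefined (cong c′ (sym (north-east^ m (east q)))))
                (subst IsDefined (cong (c′ ∘ east) (north-east^ m (east q))) den))

  gap-extends-east′ : ∀ q → d q ≢ undef → d (east q) ≡ undef → ∀ j → d (east^ (suc j) (east q)) ≡ undef
  gap-extends-east′ q d[q]≢ d[eq] j = from (c′ q) refl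
    where
    c′[eq] = proj₁ (undef⁻¹ d[eq])
    r = east^ (suc j) (east q)
    north-r : north r ≡ east^ (suc (suc j)) (north q)
    north-r = trans (north-east^ (suc j) (east q)) (east^-east (suc j) (north q))
    occupied : c′ q ≢ undef → d r ≡ undef
    occupied c′[q]≢ = undef-stays (gap-extends-east q c′[q]≢ c′[eq] j) λ (h , de) → no-spawn h de
      where
      no-spawn : IsHalf (c′ (north r)) → IsDefined (c′ (east (north r))) → ⊥
      no-spawn h de with trichotomy (y q)
      ... | inj₂ (inj₂ y>) = c′[q]≢ (above-top-undef q y>)
      ... | inj₂ (inj₁ y≡) with sign-trichotomy (x (east q))
      ...   | inj₁ n = top-row-occupied (east q) y≡ n c′[eq]
      ...   | inj₂ nonNeg = ¬IsDefined-undef (subst IsDefined (east-undef _ (Posℤ-east^ (suc j) (east q) nonNeg)) de)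
      no-spawn h de | inj₁ y< with sign-trichotomy (x q)
      ...   | inj₁ n = let (_ , _ , c′[nq]) = IsDefined⇒≡def (occupied-has-defined-north q n y< c′[q]≢)
                           (_ , c′[nr]) = IsHalf⇒≡half h
                       in east-of-defined-not-half c′[nq] (suc (suc j)) (trans (cong c′ (sym north-r)) c′[nr])
      ...   | inj₂ nonNeg = ¬IsDefined-undef (subst IsDefined
                (east-undef _ (Posℤ-east^ (suc j) (east q) (inj₂ (nonNeg-suc nonNeg)))) de)
    from : ∀ a → c′ q ≡ a → d r ≡ undef
    from (half _) c′[q] = occupied (half≢undef ∘ trans (sym c′[q]))
    from (def _ _) c′[q] = occupied (def≢undef ∘ trans (sym c′[q]))
    from undef c′[q] = undef-stays (row-below-defined-empty q y< c′[enq] c′[eq] (suc j)) λ (h , _) →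
      let (_ , c′[nr]) = IsHalf⇒≡half h in east-of-defined-not-half c′[enq] (suc j) (trans (cong c′ (sym (north-east^ (suc j) (east q)))) c′[nr])
      where
      spawn : IsHalf (c′ (north q)) × IsDefined (c′ (east (north q)))
      spawn = decidable-stable (isHalf? _ ×-dec isDefined? _) (d[q]≢ ∘ undef-stays c′[q])
      c′[nq] = proj₂ (IsHalf⇒≡half (proj₁ spawn))
      c′[enq] = proj₂ (proj₂ (IsDefined⇒≡def (proj₂ spawn)))
      y< : y q < top
      y< with half-row c′[nq]
      ... | inj₁ y+1< = suc<⇒< y+1<
      ... | inj₂ (y+1≡ , _) = suc≡⇒< y+1≡

  axis-west-gap′ : ∀ q → x (east q) ≡ + 0 → y q < top → d q ≡ undef → IsDefined (d (east q)) →
    ¬ IsDefined (d (north q)) × IsDefined (d (east (north q)))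
  axis-west-gap′ q z y< d[q] de with undef⁻¹ d[q]
  ... | (c′[q] , ¬spawn) = north-not-defined (c′ (north q)) refl , IsDefined-stays (proj₂ gap)
    where
    c′[eq]-defined : IsDefined (c′ (east q))
    c′[eq]-defined with IsDefined⇒≡def de
    ... | (u , v , d[eq]) with def⁻¹ d[eq]
    ...   | inj₁ r = subst IsDefined (sym r) (isDef u v)
    ...   | inj₂ (h , _) = ⊥-elim (axis-not-half (east q) z h)
    gap = axis-west-gap q z y< c′[q] c′[eq]-defined
    north-not-defined : ∀ a → c′ (north q) ≡ a → ¬ IsDefined (d (north q))
    north-not-defined undef c′[nq] = undef⇒¬IsDefined c′[nq]
    north-not-defined (half s) c′[nq] _ = ¬spawn (subst IsHalf (sym c′[nq]) (isHalf s) , proj₂ gap)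
    north-not-defined (def a k) c′[nq] _ = proj₁ gap (subst IsDefined (sym c′[nq]) (isDef a k))

  inv′ : Inv d
  inv′ = record
    { above-top-undef = above-top-undef′
    ; east-undef = east-undef′
    ; axis-not-half = axis-not-half′
    ; top-row-occupied = top-row-occupied′
    ; sum-justified = sum-justified′
    ; one-has-east-neighbour = one-has-east-neighbour′
    ; sum-into-gap-zero = sum-into-gap-zero′
    ; defined-has-west-neighbour = defined-has-west-neighbour′
    ; occupied-has-defined-north = occupied-has-defined-north′
    ; half-after-gap-has-half-north = half-after-gap-has-half-north′
    ; defined-not-before-half = defined-not-before-half′
    ; defined-before-gap = defined-before-gap′
    ; half-before-gap = half-before-gap′
    ; half-half-zeroOrUndef-eastward = half-half-zeroOrUndef-eastward′
    ; gap-extends-east = gap-extends-east′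
    ; axis-west-gap = axis-west-gap′
    }

-- The initial configuration

length-encode3'-aux : ∀ f (α : List (Fin 3)) → length (encode3'-aux f α) ≡ length α
length-encode3'-aux f [] = refl
length-encode3'-aux f (fzero ∷ α) = cong suc (length-encode3'-aux false α)
length-encode3'-aux f (fsuc (fsuc fzero) ∷ α) = cong suc (length-encode3'-aux true α)
length-encode3'-aux true (fsuc fzero ∷ α) = cong suc (length-encode3'-aux true α)
length-encode3'-aux false (fsuc fzero ∷ α) = cong suc (length-encode3'-aux false α)

initCol-beyond : ∀ (ws : List Sym3') j → length ws ℕ.≤ j → initCol ws j ≡ undef
initCol-beyond [] j _ = refl
initCol-beyond (_ ∷ ws) (suc j) (s≤s le) = initCol-beyond ws j le

symState-defined : ∀ a → IsDefined (symState a)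
symState-defined s0 = isDef _ _
symState-defined s0̄ = isDef _ _
symState-defined s1 = isDef _ _
symState-defined s1̄ = isDef _ _

initCol-within : ∀ (ws : List Sym3') j → j ℕ.< length ws → IsDefined (initCol ws j)
initCol-within (a ∷ ws) zero _ = symState-defined a
initCol-within (a ∷ ws) (suc j) (s≤s lt) = initCol-within ws j lt

module InitialInv (α : List (Fin 3)) where
  L = length α
  top = + L
  open Invariant top

  length-encode3' : length (encode3' α) ≡ L
  length-encode3' = length-encode3'-aux false α

  c₀-east : ∀ p → Posℤ (x p) → c₀ α p ≡ undef
  c₀-east (+ suc _ , _) pos = refl

  c₀-west : ∀ p → Negℤ (x p) → (y p ≡ top × c₀ α p ≡ half false) ⊎ (y p ≢ top × c₀ α p ≡ undef)
  c₀-west (-[1+ _ ] , -[1+ _ ]) neg = inj₂ ((λ ()) , refl)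
  c₀-west (-[1+ _ ] , + k) neg with k ℕ.≡ᵇ L in k≡ᵇL
  ... | true = inj₁ (cong +_ (ℕP.≡ᵇ⇒≡ k L (subst T (sym k≡ᵇL) _)) , refl)
  ... | false = inj₂ ((λ { refl → subst T k≡ᵇL (ℕP.≡⇒≡ᵇ k k refl) }) , refl)

  c₀-axis : ∀ p → x p ≡ + 0 → c₀ α p ≡ undef ⊎ IsDefined (c₀ α p)
  c₀-axis (+ zero , + suc j) refl with j ℕ.<? length (encode3' α)
  ... | yes lt = inj₂ (initCol-within (encode3' α) j lt)
  ... | no ¬lt = inj₁ (initCol-beyond (encode3' α) j (ℕP.≮⇒≥ ¬lt))
  c₀-axis (+ zero , + zero) refl = inj₁ refl
  c₀-axis (+ zero , -[1+ _ ]) refl = inj₁ refl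

  c₀-axis-defined⁻¹ : ∀ p → x p ≡ + 0 → IsDefined (c₀ α p) → Σ ℕ λ j → y p ≡ + suc j × j ℕ.< L
  c₀-axis-defined⁻¹ (+ zero , + suc j) refl de with j ℕ.<? length (encode3' α)
  ... | yes lt = j , refl , subst (j ℕ.<_) length-encode3' lt
  ... | no ¬lt = ⊥-elim (¬IsDefined-undef (subst IsDefined (initCol-beyond (encode3' α) j (ℕP.≮⇒≥ ¬lt)) de))

  c₀-axis-defined : ∀ j → j ℕ.< L → IsDefined (c₀ α (+ 0 , + suc j))
  c₀-axis-defined j lt = initCol-within (encode3' α) j (subst (j ℕ.<_) (sym length-encode3') lt)

  module _ (c : Config) (c≗c₀ : ∀ p → c p ≡ c₀ α p) where

    east-undef₀ : ∀ p → Posℤ (x p) → c p ≡ undef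
    east-undef₀ p ps = trans (c≗c₀ p) (c₀-east p ps)

    occupied-cell : ∀ {p} → c p ≢ undef →
      (x p ≡ + 0 × IsDefined (c p)) ⊎ (Negℤ (x p) × y p ≡ top × c p ≡ half false)
    occupied-cell {p} c[p]≢ with sign-trichotomy (x p)
    ... | inj₂ (inj₂ ps) = ⊥-elim (c[p]≢ (east-undef₀ p ps))
    ... | inj₂ (inj₁ z) with c₀-axis p z
    ...   | inj₁ u = ⊥-elim (c[p]≢ (trans (c≗c₀ p) u))
    ...   | inj₂ de = inj₁ (z , subst IsDefined (sym (c≗c₀ p)) de)
    occupied-cell {p} c[p]≢ | inj₁ n with c₀-west p n
    ...   | inj₁ (y≡ , c₀[p]) = inj₂ (n , y≡ , trans (c≗c₀ p) c₀[p])
    ...   | inj₂ (_ , u) = ⊥-elim (c[p]≢ (trans (c≗c₀ p) u))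

    half-cell : ∀ {p s} → c p ≡ half s → Negℤ (x p) × y p ≡ top × s ≡ false
    half-cell {p} c[p] with occupied-cell (half≢undef ∘ trans (sym c[p]))
    ... | inj₁ (_ , de) = ⊥-elim (¬IsDefined-half (subst IsDefined c[p] de))
    ... | inj₂ (n , y≡ , c[p]′) = n , y≡ , half-injective (trans (sym c[p]) c[p]′)
      where
      half-injective : ∀ {a b} → half a ≡ half b → a ≡ b
      half-injective refl = refl

    defined-cell : ∀ {p} → IsDefined (c p) → x p ≡ + 0 × Σ ℕ λ j → y p ≡ + suc j × j ℕ.< L
    defined-cell {p} de with occupied-cell (λ u → ¬IsDefined-undef (subst IsDefined u de))
    ... | inj₁ (z , _) = z , c₀-axis-defined⁻¹ p z (subst IsDefined (c≗c₀ p) de)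
    ... | inj₂ (_ , _ , c[p]) = ⊥-elim (¬IsDefined-half (subst IsDefined c[p] de))

    defined-on-axis : ∀ {q a k} → c q ≡ def a k → x q ≡ + 0
    defined-on-axis c[q] = proj₁ (defined-cell (subst IsDefined (sym c[q]) (isDef _ _)))

    above-top-undef₀ : ∀ p → top < y p → c p ≡ undef
    above-top-undef₀ p y> with c p ≟ₛ undef
    ... | yes u = u
    ... | no c[p]≢ with occupied-cell c[p]≢
    ...   | inj₁ (_ , de) with defined-cell de
    ...     | _ , j , y≡ , j<L with subst (top <_) y≡ y>
    ...       | +<+ L<1+j = ⊥-elim (ℕP.<⇒≱ j<L (ℕP.≤-pred L<1+j))
    above-top-undef₀ p y> | no _ | inj₂ (_ , y≡ , _) = ⊥-elim (≡⇒≯ y≡ y>)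

    top-row-occupied₀ : ∀ p → y p ≡ top → Negℤ (x p) → c p ≢ undef
    top-row-occupied₀ p y≡ n c[p] with c₀-west p n
    ... | inj₁ (_ , c₀[p]) = half≢undef (trans (sym c₀[p]) (trans (sym (c≗c₀ p)) c[p]))
    ... | inj₂ (y≢ , _) = y≢ y≡

    sum-justified₀ : ∀ p {s} → sumBit (c p) ≡ just s → SumJustified c p s
    sum-justified₀ p σ≡ with c p in c[p]
    ... | half _ = let (_ , y≡ , s≡) = half-cell c[p] in inj₁ (y≡ , trans (just-injective σ≡) s≡)
      where
      just-injective : ∀ {a b : Bool} → just a ≡ just b → b ≡ a
      just-injective refl = refl
    ... | def _ _ = inj₂ (inj₁ (defined-on-axis c[p]))

    gap-extends-east₀ : ∀ q → c q ≢ undef → c (east q) ≡ undef → ∀ j → c (east^ (suc j) (east q)) ≡ undef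
    gap-extends-east₀ q c[q]≢ c[eq] j with sign-trichotomy (x (east q))
    ... | inj₂ nonNeg = east-undef₀ _ (Posℤ-east^ j (east q) nonNeg)
    ... | inj₁ n with occupied-cell c[q]≢
    ...   | inj₁ (z , _) = ⊥-elim (Negℤ⇒≢0 (Negℤ-suc⁻¹ n) z)
    ...   | inj₂ (_ , y≡ , _) = ⊥-elim (top-row-occupied₀ (east q) y≡ n c[eq])

    axis-west-gap₀ : ∀ q → x (east q) ≡ + 0 → y q < top → c q ≡ undef → IsDefined (c (east q)) →
      ¬ IsDefined (c (north q)) × IsDefined (c (east (north q)))
    axis-west-gap₀ q z y< _ de with defined-cell de
    ... | (_ , j , y≡ , _) = (λ dn → Negℤ⇒≢0 (suc≡0⇒Negℤ z) (proj₁ (defined-cell dn))) ,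
        subst IsDefined (sym (trans (c≗c₀ (east (north q))) (cong (c₀ α) (cong₂ _,_ z (cong ℤ.suc y≡)))))
          (c₀-axis-defined (suc j) (next-row (subst (_< top) y≡ y<)))
      where
      next-row : + suc j < top → suc j ℕ.< L
      next-row (+<+ lt) = lt

    inv₀ : Inv c
    inv₀ = record
      { above-top-undef = above-top-undef₀
      ; east-undef = east-undef₀
      ; axis-not-half = λ p z c[p] → Negℤ⇒≢0 (proj₁ (half-cell c[p])) z
      ; top-row-occupied = top-row-occupied₀
      ; sum-justified = sum-justified₀
      ; one-has-east-neighbour = λ q c[q] → case proj₂ (proj₂ (half-cell c[q])) of λ ()
      ; sum-into-gap-zero = λ q n c[enq] → ⊥-elim (Negℤ⇒≢0 n (defined-on-axis c[enq]))
      ; defined-has-west-neighbour = λ q n c[eq] → ⊥-elim (Negℤ⇒≢0 n (defined-on-axis c[eq]))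
      ; occupied-has-defined-north = λ p n y< c[p]≢ → case occupied-cell c[p]≢ of λ
          { (inj₁ (z , _)) → ⊥-elim (Negℤ⇒≢0 n z)
          ; (inj₂ (_ , y≡ , _)) → ⊥-elim (<⇒≢ y< y≡) }
      ; half-after-gap-has-half-north = λ q y< c[eq] → ⊥-elim (<⇒≢ y< (proj₁ (proj₂ (half-cell c[eq]))))
      ; defined-not-before-half = λ q c[q] c[eq] →
          Negℤ⇒¬Posℤ (proj₁ (half-cell c[eq])) (nonNeg-suc (inj₁ (defined-on-axis c[q])))
      ; defined-before-gap = λ q n _ c[q] → ⊥-elim (Negℤ⇒≢0 n (defined-on-axis c[q]))
      ; half-before-gap = λ p y< c[p] → ⊥-elim (<⇒≢ y< (proj₁ (proj₂ (half-cell c[p]))))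
      ; half-half-zeroOrUndef-eastward = λ q y< c[q] → ⊥-elim (<⇒≢ y< (proj₁ (proj₂ (half-cell c[q]))))
      ; gap-extends-east = gap-extends-east₀
      ; axis-west-gap = axis-west-gap₀
      }

-- Parities and the limit configuration

bitParity : Bool → Parity
bitParity false = 0ℙ
bitParity true = 1ℙ

bitParity-xor : ∀ a b → bitParity (a xor b) ≡ bitParity a ℙ.+ bitParity b
bitParity-xor false b = refl
bitParity-xor true false = refl
bitParity-xor true true = refl

%2≡bitℕ : ∀ n {b} → parity n ≡ bitParity b → n % 2 ≡ bitℕ b
%2≡bitℕ zero {false} _ = refl
%2≡bitℕ (suc zero) {true} _ = refl
%2≡bitℕ (suc (suc n)) p≡ = trans (cong (_% 2) (ℕP.+-comm 2 n)) (trans ([m+n]%n≡m%n n 2) (%2≡bitℕ n p≡))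

symState-parity : ∀ a {u v} → symState a ≡ def u v → bitParity (u xor v) ≡ parity (symDigit a)
symState-parity s0 refl = refl
symState-parity s0̄ refl = refl
symState-parity s1 refl = refl
symState-parity s1̄ refl = refl

val3'-parity : ∀ a q → parity (val3' (a ∷ q)) ≡ parity (symDigit a) ℙ.+ parity (val3' q)
val3'-parity a q = begin
  parity (symDigit a ℕ.+ 3 ℕ.* val3' q)               ≡⟨ ℙP.+-homo-+ (symDigit a) (3 ℕ.* val3' q) ⟩
  parity (symDigit a) ℙ.+ parity (3 ℕ.* val3' q)      ≡⟨ cong (parity (symDigit a) ℙ.+_) (ℙP.*-homo-* 3 (val3' q)) ⟩
  parity (symDigit a) ℙ.+ parity (val3' q)            ∎
  where open ≡-Reasoning

module ColumnParity (top : ℤ) (c : Config)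
  (above-top-undef : ∀ p → top < y p → c p ≡ undef)
  (east-undef : ∀ p → Posℤ (x p) → c p ≡ undef)
  (sum-justified : ∀ p {s} → sumBit (c p) ≡ just s → Invariant.SumJustified top c p s) where
  open Invariant top using (SumOfNorth; ≡⇒<suc)

  sum-of-north : ∀ u {s} → sumBit (c u) ≡ just s → IsDefined (c (east (north u))) → SumOfNorth c u s
  sum-of-north u σ≡ de with sum-justified u σ≡
  ... | inj₁ (y≡ , _) = ⊥-elim (¬IsDefined-undef (subst IsDefined (above-top-undef _ (≡⇒<suc y≡)) de))
  ... | inj₂ (inj₁ z) = ⊥-elim (¬IsDefined-undef (subst IsDefined (east-undef _ (nonNeg-suc (inj₁ z))) de))
  ... | inj₂ (inj₂ r) = r

  top-of-column : ∀ u {s} → sumBit (c u) ≡ just s → IsDefined (c (east u)) → ¬ IsDefined (c (east (north u))) →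
    s ≡ false
  top-of-column u σ≡ de ¬de with sum-justified u σ≡
  ... | inj₁ (_ , s≡) = s≡
  ... | inj₂ (inj₁ z) = ⊥-elim (¬IsDefined-undef (subst IsDefined (east-undef _ (nonNeg-suc (inj₁ z))) de))
  ... | inj₂ (inj₂ (_ , _ , _ , _ , c[enu] , _)) = ⊥-elim (¬de (subst IsDefined (sym c[enu]) (isDef _ _)))

  column-parity : ∀ a q u {s} → sumBit (c u) ≡ just s →
    (∀ (j : Fin (length (a ∷ q))) → c (north^ (suc (toℕ j)) (east u)) ≡ symState (lookup (a ∷ q) j)) →
    ¬ IsDefined (c (north^ (suc (length (a ∷ q))) (east u))) →
    parity (val3' (a ∷ q)) ≡ bitParity s
  column-parity a q u {s} σ≡ column ¬above
    with sum-of-north u σ≡ (subst IsDefined (sym (column fzero)) (symState-defined a))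
  ... | t , u₂ , v₂ , σn , c[enu] , s≡ = begin
    parity (val3' (a ∷ q))                     ≡⟨ val3'-parity a q ⟩
    parity (symDigit a) ℙ.+ parity (val3' q)   ≡⟨ cong₂ ℙ._+_ (sym (symState-parity a first-digit)) (rest q column ¬above) ⟩
    bitParity (u₂ xor v₂) ℙ.+ bitParity t      ≡⟨ ℙP.+-comm (bitParity (u₂ xor v₂)) (bitParity t) ⟩
    bitParity t ℙ.+ bitParity (u₂ xor v₂)      ≡⟨ sym (bitParity-xor t (u₂ xor v₂)) ⟩
    bitParity (t xor (u₂ xor v₂))              ≡⟨ cong bitParity (sym s≡) ⟩
    bitParity s                                ∎
    where
    open ≡-Reasoning
    first-digit : symState a ≡ def u₂ v₂
    first-digit = trans (sym (column fzero)) c[enu]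
    shift : ∀ i → north^ i (east (north u)) ≡ north^ (suc i) (east u)
    shift i = north^-north i (east u)
    rest : ∀ q → (∀ (j : Fin (length (a ∷ q))) → c (north^ (suc (toℕ j)) (east u)) ≡ symState (lookup (a ∷ q) j)) →
      ¬ IsDefined (c (north^ (suc (length (a ∷ q))) (east u))) → parity (val3' q) ≡ bitParity t
    rest [] _ ¬above =
      cong bitParity (sym (top-of-column (north u) σn (subst IsDefined (sym c[enu]) (isDef u₂ v₂)) ¬above))
    rest (b ∷ q′) column ¬above = column-parity b q′ (north u) σn
      (λ j → trans (cong c (shift (suc (toℕ j)))) (column (fsuc j)))
      (¬above ∘ subst IsDefined (cong c (shift (suc (length (b ∷ q′))))))

module Limit (α : List (Fin 3)) (cs : ℕ → Config) (cinf : Config)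
             (orbit : IsOrbit α cs) (limit : IsPointwiseLimit cs cinf) where
  top = + length α
  open Invariant top

  inv : ∀ m → Inv (cs m)
  inv zero = InitialInv.inv₀ α (cs 0) (proj₁ orbit)
  inv (suc m) with proj₂ orbit m
  ... | c′ , nl , local = LocalPreservesInv.inv′ top local (NonLocalPreservesInv.inv′ top nl (inv m))
                            (NonLocalStep.no-pending-carry nl)

  frozen : ∀ p → Σ ℕ λ M → cs M p ≡ cinf p
  frozen p = let (M , f) = limit p in M , f M ℕP.≤-refl

  frozen₃ : ∀ p q r → Σ ℕ λ M → cs M p ≡ cinf p × cs M q ≡ cinf q × cs M r ≡ cinf r
  frozen₃ p q r = M , f₁ M (ℕP.m≤m⊔n M₁ _) ,
                  f₂ M (ℕP.≤-trans (ℕP.m≤m⊔n M₂ M₃) (ℕP.m≤n⊔m M₁ _)) ,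
                  f₃ M (ℕP.≤-trans (ℕP.m≤n⊔m M₂ M₃) (ℕP.m≤n⊔m M₁ _))
    where
    M₁ = proj₁ (limit p)
    M₂ = proj₁ (limit q)
    M₃ = proj₁ (limit r)
    f₁ = proj₂ (limit p)
    f₂ = proj₂ (limit q)
    f₃ = proj₂ (limit r)
    M = M₁ ℕ.⊔ (M₂ ℕ.⊔ M₃)

  above-top-undef∞ : ∀ p → top < y p → cinf p ≡ undef
  above-top-undef∞ p y> = let (M , cs≡) = frozen p in trans (sym cs≡) (Inv.above-top-undef (inv M) p y>)

  east-undef∞ : ∀ p → Posℤ (x p) → cinf p ≡ undef
  east-undef∞ p ps = let (M , cs≡) = frozen p in trans (sym cs≡) (Inv.east-undef (inv M) p ps)

  sum-justified∞ : ∀ p {s} → sumBit (cinf p) ≡ just s → SumJustified cinf p s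
  sum-justified∞ p {s} σ≡ with frozen₃ p (north p) (east (north p))
  ... | M , cs≡ , cs≡ₙ , cs≡ₑₙ with Inv.sum-justified (inv M) p (trans (cong sumBit cs≡) σ≡)
  ... | inj₁ top-row = inj₁ top-row
  ... | inj₂ (inj₁ axis) = inj₂ (inj₁ axis)
  ... | inj₂ (inj₂ (t , u , v , σn , c[en] , s≡)) =
    inj₂ (inj₂ (t , u , v , trans (cong sumBit (sym cs≡ₙ)) σn , trans (sym cs≡ₑₙ) c[en] , s≡))

  open ColumnParity top cinf above-top-undef∞ east-undef∞ sum-justified∞ public

corollary20 : (α : List (Fin 3)) (cs : ℕ → Config) (cinf : Config) →
    IsOrbit α cs → IsPointwiseLimit cs cinf →
    (e : Pos) (s k : Bool) →
    IsDefined (cinf (e ⊕ N)) → cinf (e ⊕ W) ≡ def s k →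
    (q : List Sym3') →
    (∀ (j : Fin (length q)) → cinf (e ⊕ (+ 0 , + suc (toℕ j))) ≡ symState (lookup q j)) →
    ¬ IsDefined (cinf (e ⊕ (+ 0 , + suc (length q)))) →
    val3' q % 2 ≡ bitℕ s
corollary20 α cs cinf orbit limit e s k north-defined west≡ [] _ ¬above = ⊥-elim (¬above north-defined)
corollary20 α cs cinf orbit limit e s k north-defined west≡ (a ∷ q) column ¬above =
  %2≡bitℕ (val3' (a ∷ q)) (column-parity a q (west e) σ≡ column′ ¬above′)
  where
  open Limit α cs cinf orbit limit
  σ≡ : sumBit (cinf (west e)) ≡ just s
  σ≡ = cong sumBit (trans (cong cinf (sym (⊕W≡west e))) west≡)
  column-cell : ∀ i → north^ i (east (west e)) ≡ e ⊕ (+ 0 , + i)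
  column-cell i = trans (cong (north^ i) (east-west e)) (sym (⊕column≡north^ e i))
  column′ : ∀ (j : Fin (length (a ∷ q))) → cinf (north^ (suc (toℕ j)) (east (west e))) ≡ symState (lookup (a ∷ q) j)
  column′ j = trans (cong cinf (column-cell (suc (toℕ j)))) (column j)
  ¬above′ : ¬ IsDefined (cinf (north^ (suc (length (a ∷ q))) (east (west e))))
  ¬above′ = ¬above ∘ subst IsDefined (cong cinf (column-cell (suc (length (a ∷ q)))))
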